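{- For $n\ge1$ and every $k$, the number of type $B$ set partitions of $\langle n\rangle$ having $k$ blocks equals the number of type $B$ separated set partitions of $\langle n+1\rangle$ without zero block having $k$ blocks.
   Context: $\langle n\rangle=\{0,\pm1,\dots,\pm n\}$. A type $B$ set partition of $\langle n\rangle$ is a set partition of $\langle n\rangle$ consisting of one block $\pi_0$ containing $0$ with $a\in\pi_0\iff-a\in\pi_0$ (the zero block) and pairs of blocks $\beta,-\beta\ne\beta$. Its number of blocks is $1$ plus the number of pairs $\{\beta,-\beta\}$ (i.e. the zero block, possibly $\{0\}$, is counted once and each pair counted once). A partition without zero block is one whose zero block is $\{0\}$; its blocks are counted as the number of pairs $\{\beta,-\beta\}$. A succession of a partition without zero block is an $a\in\{2,\dots,n\}$ such that $a-1,a$ lie in the same block (equivalently $-(a-1),-a$ lie in a common block); the partition is separated if it has no succession. -}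

module Defs where

open import Data.Bool using (Bool; true; false; _∧_; _∨_; not; if_then_else_)
open import Data.Nat using (ℕ; zero; suc; _+_; _∸_; _≤ᵇ_; _<ᵇ_; _≡ᵇ_; ⌊_/2⌋)
open import Data.Fin using (Fin; toℕ; _↑ˡ_; _↑ʳ_)
open import Data.List using (List; []; _∷_; map; _++_; concatMap; allFin)
open import Data.Bool.ListAction using (all; any)
open import Data.Vec using (Vec; lookup) renaming ([] to []ᵥ; _∷_ to _∷ᵥ_)

-- Elements of ⟨n⟩ = {0, ±1, ..., ±n}: zer = 0, pos i = i+1, neg i = -(i+1).
data Elem (n : ℕ) : Set where
  zer : Elem n
  pos : Fin n → Elem n
  neg : Fin n → Elem n

negE : ∀ {n} → Elem n → Elem n
negE zer     = zer
negE (pos i) = neg i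
negE (neg i) = pos i

elems : (n : ℕ) → List (Elem n)
elems n = zer ∷ (map pos (allFin n) ++ map neg (allFin n))

size : ℕ → ℕ
size n = suc (n + n)

idx : ∀ {n} → Elem n → Fin (size n)
idx zer             = Fin.zero
idx {n} (pos i)     = Fin.suc (i ↑ˡ n)
idx {n} (neg i)     = Fin.suc (n ↑ʳ i)

allVecs : (m : ℕ) → List (Vec Bool m)
allVecs zero    = []ᵥ ∷ []
allVecs (suc m) = concatMap (λ b → map (b ∷ᵥ_) (allVecs m)) (true ∷ false ∷ [])

allMats : (r c : ℕ) → List (Vec (Vec Bool c) r)
allMats zero    c = []ᵥ ∷ []
allMats (suc r) c = concatMap (λ v → map (v ∷ᵥ_) (allMats r c)) (allVecs c)

record BRel (n : ℕ) : Set where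
  constructor mkRel
  field matrix : Vec (Vec Bool (size n)) (size n)

rel : ∀ {n} → BRel n → Elem n → Elem n → Bool
rel (mkRel R) a b = lookup (lookup R (idx a)) (idx b)

allRels : (n : ℕ) → List (BRel n)
allRels n = map mkRel (allMats (size n) (size n))

_⇒ᵇ_ : Bool → Bool → Bool
a ⇒ᵇ b = not a ∨ b

countB : ∀ {A : Set} → (A → Bool) → List A → ℕ
countB p []       = zero
countB p (x ∷ xs) = if p x then suc (countB p xs) else countB p xs

-- R is an equivalence relation on ⟨n⟩ (i.e. encodes a set partition of ⟨n⟩:
-- the blocks are the equivalence classes)
isEquiv : ∀ {n} → BRel n → Bool
isEquiv {n} R =
  all (λ a → rel R a a) (elems n) ∧
  all (λ a → all (λ b → rel R a b ⇒ᵇ rel R b a) (elems n)) (elems n) ∧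
  all (λ a → all (λ b → all (λ c → (rel R a b ∧ rel R b c) ⇒ᵇ rel R a c)
                                 (elems n)) (elems n)) (elems n)

-- Type B set partition of ⟨n⟩: a set partition such that
--  (i)  if β is a block then so is -β   (a ~ b ⇒ -a ~ -b), and
--  (ii) the only block with β = -β is the block containing 0
--       (a ~ -a ⇒ a ~ 0).
-- Then the zero block is closed under negation and every other block β
-- comes with -β ≠ β.
isTypeB : ∀ {n} → BRel n → Bool
isTypeB {n} R =
  isEquiv R ∧
  all (λ a → all (λ b → rel R a b ⇒ᵇ rel R (negE a) (negE b)) (elems n)) (elems n) ∧
  all (λ a → rel R a (negE a) ⇒ᵇ rel R a zer) (elems n)

numClasses : ∀ {n} → BRel n → ℕ
numClasses {n} R =
  countB (λ a → all (λ b → rel R a b ⇒ᵇ (toℕ (idx a) ≤ᵇ toℕ (idx b))) (elems n)) (elems n)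

-- number of pairs {β,-β} of non-zero blocks: (#classes - 1)/2
numPairs : ∀ {n} → BRel n → ℕ
numPairs R = ⌊ numClasses R ∸ 1 /2⌋

-- blocks of a type B partition: zero block counted once + number of pairs
blocksB : ∀ {n} → BRel n → ℕ
blocksB R = suc (numPairs R)

-- without zero block: the zero block is {0}
noZeroBlock : ∀ {n} → BRel n → Bool
noZeroBlock {n} R = all (λ a → rel R a zer ⇒ᵇ isZer a) (elems n)
  where
  isZer : Elem n → Bool
  isZer zer = true
  isZer _   = false

-- succession: a ∈ {2..n} with a-1, a in the same block;
-- pos i represents toℕ i + 1, so this is pos i ~ pos j with toℕ j = toℕ i + 1
hasSuccession : ∀ {n} → BRel n → Bool
hasSuccession {n} R =
  any (λ i → any (λ j → (toℕ j ≡ᵇ suc (toℕ i)) ∧ rel R (pos i) (pos j)) (allFin n)) (allFin n)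

isSeparatedNoZero : ∀ {n} → BRel n → Bool
isSeparatedNoZero R = isTypeB R ∧ noZeroBlock R ∧ not (hasSuccession R)

numTypeB : ℕ → ℕ → ℕ
numTypeB n k =
  countB (λ R → isTypeB R ∧ (blocksB R ≡ᵇ k)) (allRels n)

-- number of type B separated set partitions of ⟨n⟩ without zero block with
-- k blocks (blocks counted as the number of pairs {β,-β})
numSepNoZero : ℕ → ℕ → ℕ
numSepNoZero n k =
  countB (λ R → isSeparatedNoZero R ∧ (numPairs R ≡ᵇ k)) (allRels n)

-- A relation on ⟨n⟩ is a Boolean function on ⟨n⟩², so counting relations means summing over Boolean
-- assignments to the pairs.  Weight every type B partition by a function φ of its number c of classes.
-- Deleting ±1 from a type B partition of ⟨n+1⟩ leaves one of ⟨n⟩, and a type B partition of ⟨n⟩ with c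
-- classes has exactly c + 1 such extensions: 1 joins one of the c classes (and −1 its negative), which
-- keeps c classes, or {1} and {−1} form a new pair, which gives c + 2.  Inserting a new element 1 in front
-- of a separated partition of ⟨m+1⟩ without zero block works the same way, except that 1 may join neither
-- the zero block nor the block of the old 1, so c − 2 classes are available.  For the weighted counts
-- A(n, φ) of type B partitions of ⟨n⟩ and B(n, ψ) of separated ones without zero block this gives
--   A(n+1, φ) = A(n, c ↦ c φ(c) + φ(c+2)),   B(m+2, ψ) = B(m+1, c ↦ (c−2) ψ(c) + ψ(c+2)),
-- and as A(0, φ) = φ(1) and B(1, ψ) = ψ(3), induction gives A(n, φ) = B(n+1, c ↦ φ(c−2)).  The theorem is
-- the case where φ(c) indicates that c classes make k blocks.

module Submission where

open import Defs
open import Data.Nat using (ℕ; suc; _≤_)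
open import Relation.Binary.PropositionalEquality using (_≡_)

open import Data.Bool using (Bool; true; false; _∧_; _∨_; not; if_then_else_)
import Data.Bool.Properties as Bool
open import Data.Bool.ListAction using (and; or; all; any)
open import Data.Empty using (⊥; ⊥-elim)
open import Data.Fin using (Fin; toℕ; splitAt) renaming (zero to fz; suc to fs)
import Data.Fin.Properties as Fin
open import Data.List using (List; []; _∷_; map; _++_; concatMap; allFin; tabulate; length; cartesianProduct)
open import Data.List.Properties using (map-++; map-∘; map-tabulate; map-cong-local)
open import Data.List.Membership.Propositional using (_∈_)
open import Data.List.Membership.Propositional.Properties
  using (∈-map⁺; ∈-map⁻; ∈-++⁺ˡ; ∈-++⁺ʳ; ∈-++⁻; ∈-allFin; ∈-cartesianProduct⁺; ∈-cartesianProduct⁻)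
open import Data.List.Membership.Propositional.Properties.WithK using (unique∧set⇒bag)
open import Data.List.Relation.Binary.BagAndSetEquality using (∼bag⇒↭)
open import Data.List.Relation.Binary.Disjoint.Propositional using (Disjoint)
open import Data.List.Relation.Binary.Permutation.Propositional
  using (_↭_; prep; swap; ↭-sym; ↭⇒↭ₛ) renaming (refl to ↭-refl; trans to ↭-trans)
open import Data.List.Relation.Binary.Permutation.Propositional.Properties using (map⁺; ∈-resp-↭; ↭-length)
import Data.List.Relation.Binary.Permutation.Setoid.Properties as PermutationProperties
open import Data.List.Relation.Unary.All using (All; []; _∷_) renaming (lookup to All-lookup)
import Data.List.Relation.Unary.All as All
open import Data.List.Relation.Unary.Any using (here; there)
open import Data.List.Relation.Unary.Unique.Propositional using (Unique; []; _∷_)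
import Data.List.Relation.Unary.Unique.Propositional.Properties as Unique
open import Data.Maybe using (Maybe; just; nothing; zip)
open import Data.Maybe.Properties using (just-injective)
open import Data.Nat using (zero; pred; _+_; _*_; _∸_; _<_; _≤ᵇ_; _≡ᵇ_; ⌊_/2⌋; s≤s⁻¹)
open import Data.Nat.ListAction using (sum)
open import Data.Nat.ListAction.Properties using (sum-++; sum-↭)
open import Data.Nat.Properties
  using (+-identityʳ; +-suc; ≤-refl; ≤-trans; ≤-antisym; <⇒≤; ≰⇒>; <⇒≱; ≤∧≢⇒<; ≤ᵇ⇒≤; ≤⇒≤ᵇ;
         +-commutativeSemigroup)
open import Algebra.Properties.CommutativeSemigroup +-commutativeSemigroup using (interchange)
open import Data.Product using (Σ; _×_; _,_; proj₁; proj₂; uncurry)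
import Data.Product as Prod
open import Data.Product.Properties using (≡-dec; ,-injective)
open import Data.Sum using (_⊎_; inj₁; inj₂)
open import Data.Unit using (⊤; tt)
open import Data.Vec using (Vec)
import Data.Vec as Vec
open import Data.Vec.Properties using (tabulate-cong; lookup∘tabulate)
import Data.Vec.Functional as VecF
open import Function using (_∘_; const; id; case_of_)
open import Function.Bundles using (Equivalence; mk⇔)
open import Relation.Binary using (DecidableEquality; _Preserves_⟶_)
open import Relation.Nullary using (yes; no; does; ¬_)
open import Relation.Nullary.Decidable using (dec-true; map′)
open import Relation.Binary.PropositionalEquality
  using (refl; sym; trans; cong; cong₂; subst; _≢_; _≗_; setoid; module ≡-Reasoning)

private variable A B : Set

sumMap : (A → ℕ) → List A → ℕ
sumMap G xs = sum (map G xs)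

sumMap-++ : (G : A → ℕ) (xs ys : List A) → sumMap G (xs ++ ys) ≡ sumMap G xs + sumMap G ys
sumMap-++ G xs ys = trans (cong sum (map-++ G xs ys)) (sum-++ (map G xs) (map G ys))

sumMap-↭ : (G : A → ℕ) {xs ys : List A} → xs ↭ ys → sumMap G xs ≡ sumMap G ys
sumMap-↭ G p = sum-↭ (map⁺ G p)

sumMap-map : (G : B → ℕ) (f : A → B) (xs : List A) → sumMap G (map f xs) ≡ sumMap (G ∘ f) xs
sumMap-map G f xs = cong sum (sym (map-∘ {g = G} {f = f} xs))

sumMap-concatMap : (G : B → ℕ) (f : A → List B) (xs : List A) →
  sumMap G (concatMap f xs) ≡ sumMap (sumMap G ∘ f) xs
sumMap-concatMap G f []       = refl
sumMap-concatMap G f (x ∷ xs) =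
  trans (sumMap-++ G (f x) (concatMap f xs)) (cong (sumMap G (f x) +_) (sumMap-concatMap G f xs))

sumMap-cong : {G H : A → ℕ} (xs : List A) → (∀ {x} → x ∈ xs → G x ≡ H x) → sumMap G xs ≡ sumMap H xs
sumMap-cong []       e = refl
sumMap-cong (x ∷ xs) e = cong₂ _+_ (e (here refl)) (sumMap-cong xs (e ∘ there))

sumMap-zero : {G : A → ℕ} (xs : List A) → (∀ {x} → x ∈ xs → G x ≡ 0) → sumMap G xs ≡ 0
sumMap-zero []       e = refl
sumMap-zero (x ∷ xs) e = cong₂ _+_ (e (here refl)) (sumMap-zero xs (e ∘ there))

sumMap-supportedAt : {G : A → ℕ} {c : A} (xs : List A) → Unique xs → c ∈ xs →
  (∀ {x} → x ∈ xs → x ≢ c → G x ≡ 0) → sumMap G xs ≡ G c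
sumMap-supportedAt {G = G} (x ∷ xs) (x∉ ∷ _) (here refl) e =
  trans (cong (G x +_) (sumMap-zero xs (λ y∈ → e (there y∈) (λ y≡x → All-lookup x∉ y∈ (sym y≡x)))))
        (+-identityʳ (G x))
sumMap-supportedAt {G = G} {c} (x ∷ xs) (x∉ ∷ u) (there c∈) e =
  trans (cong (_+ sumMap G xs) (e (here refl) x≢c)) (sumMap-supportedAt xs u c∈ (e ∘ there))
  where
  x≢c : x ≢ c
  x≢c refl = All-lookup x∉ c∈ refl

countB-as-sum : (p : A → Bool) (xs : List A) → countB p xs ≡ sumMap (λ x → if p x then 1 else 0) xs
countB-as-sum p []       = refl
countB-as-sum p (x ∷ xs) with p x
... | true  = cong suc (countB-as-sum p xs)
... | false = countB-as-sum p xs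

sumMap-if : (p : A → Bool) (w : ℕ) (xs : List A) → sumMap (λ x → if p x then w else 0) xs ≡ countB p xs * w
sumMap-if p w []       = refl
sumMap-if p w (x ∷ xs) with p x
... | true  = cong (w +_) (sumMap-if p w xs)
... | false = sumMap-if p w xs

≡true⇒≢false : ∀ {a} → a ≡ true → a ≢ false
≡true⇒≢false refl ()

∧-trueˡ : ∀ {a b} → a ∧ b ≡ true → a ≡ true
∧-trueˡ {true} _ = refl

∧-trueʳ : ∀ {a b} → a ∧ b ≡ true → b ≡ true
∧-trueʳ {true} e = e

∧-true : ∀ {a b} → a ≡ true → b ≡ true → a ∧ b ≡ true
∧-true refl refl = refl

⇒ᵇ-elim : ∀ {a b} → (a ⇒ᵇ b) ≡ true → a ≡ true → b ≡ true
⇒ᵇ-elim {true} e refl = e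

⇒ᵇ-intro : ∀ {a b} → (a ≡ true → b ≡ true) → (a ⇒ᵇ b) ≡ true
⇒ᵇ-intro {true}  h = h refl
⇒ᵇ-intro {false} h = refl

⇒ᵇ-false : ∀ {a b} → (a ⇒ᵇ b) ≡ false → a ≡ true × b ≡ false
⇒ᵇ-false {true} {false} _ = refl , refl

module _ (p : A → Bool) where

  all-elim : ∀ {xs} → all p xs ≡ true → ∀ {x} → x ∈ xs → p x ≡ true
  all-elim {y ∷ xs} e (here refl) = ∧-trueˡ e
  all-elim {y ∷ xs} e (there x∈) = all-elim (∧-trueʳ {p y} e) x∈

  all-intro : ∀ xs → (∀ {x} → x ∈ xs → p x ≡ true) → all p xs ≡ true
  all-intro []       h = refl
  all-intro (y ∷ xs) h = ∧-true (h (here refl)) (all-intro xs (h ∘ there))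

  all-false-witness : ∀ xs → all p xs ≡ false → Σ A (λ x → x ∈ xs × p x ≡ false)
  all-false-witness (y ∷ xs) e with p y in py
  ... | true  = let x , x∈ , px = all-false-witness xs e in x , there x∈ , px
  ... | false = y , here refl , py

  any-intro : ∀ xs {x} → x ∈ xs → p x ≡ true → any p xs ≡ true
  any-intro (y ∷ xs) (here refl) px rewrite px = refl
  any-intro (y ∷ xs) (there x∈)  px with p y
  ... | true  = refl
  ... | false = any-intro xs x∈ px

  any-true-witness : ∀ xs → any p xs ≡ true → Σ A (λ x → x ∈ xs × p x ≡ true)
  any-true-witness (y ∷ xs) e with p y in py
  ... | true  = y , here refl , py
  ... | false = let x , x∈ , px = any-true-witness xs e in x , there x∈ , px

  any-false-elim : ∀ {xs} → any p xs ≡ false → ∀ {x} → x ∈ xs → p x ≡ false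
  any-false-elim {y ∷ xs} e x∈ with p y in py
  any-false-elim {y ∷ xs} e (here refl) | false = py
  any-false-elim {y ∷ xs} e (there x∈)  | false = any-false-elim e x∈

  any-false-intro : ∀ xs → (∀ {x} → x ∈ xs → p x ≡ false) → any p xs ≡ false
  any-false-intro []       h = refl
  any-false-intro (y ∷ xs) h rewrite h (here refl) = any-false-intro xs (h ∘ there)

  all-↭ : ∀ {xs ys} → xs ↭ ys → all p xs ≡ all p ys
  all-↭ {xs} {ys} xs↭ys = Bool.⇔→≡ (mk⇔
    (λ e → all-intro ys (λ y∈ → all-elim e (∈-resp-↭ (↭-sym xs↭ys) y∈)))
    (λ e → all-intro xs (λ x∈ → all-elim e (∈-resp-↭ xs↭ys x∈))))

  any-↭ : ∀ {xs ys} → xs ↭ ys → any p xs ≡ any p ys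
  any-↭ {xs} {ys} xs↭ys = Bool.⇔→≡ (mk⇔
    (λ e → let x , x∈ , px = any-true-witness xs e in any-intro ys (∈-resp-↭ xs↭ys x∈) px)
    (λ e → let y , y∈ , py = any-true-witness ys e in any-intro xs (∈-resp-↭ (↭-sym xs↭ys) y∈) py))

  countB-↭ : ∀ {xs ys} → xs ↭ ys → countB p xs ≡ countB p ys
  countB-↭ {xs} {ys} xs↭ys =
    trans (countB-as-sum p xs) (trans (sumMap-↭ _ xs↭ys) (sym (countB-as-sum p ys)))

all-cong : {p q : A → Bool} (xs : List A) → (∀ {x} → x ∈ xs → p x ≡ q x) → all p xs ≡ all q xs
all-cong xs h = cong and (map-cong-local (All.tabulate h))

any-cong : {p q : A → Bool} (xs : List A) → (∀ {x} → x ∈ xs → p x ≡ q x) → any p xs ≡ any q xs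
any-cong xs h = cong or (map-cong-local (All.tabulate h))

any-map : (p : B → Bool) (f : A → B) (xs : List A) → any p (map f xs) ≡ any (p ∘ f) xs
any-map p f xs = cong or (sym (map-∘ {g = p} {f = f} xs))

countB-cong : {p q : A → Bool} (xs : List A) → (∀ {x} → x ∈ xs → p x ≡ q x) → countB p xs ≡ countB q xs
countB-cong             []       h = refl
countB-cong {q = q} (x ∷ xs) h rewrite h (here refl) with q x
... | true  = cong suc (countB-cong xs (h ∘ there))
... | false = countB-cong xs (h ∘ there)

countB-split : (p q : A → Bool) (xs : List A) →
  countB p xs ≡ countB (λ x → p x ∧ q x) xs + countB (λ x → p x ∧ not (q x)) xs
countB-split p q []       = refl
countB-split p q (x ∷ xs) with p x | q x
... | true  | true  = cong suc (countB-split p q xs)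
... | true  | false = trans (cong suc (countB-split p q xs)) (sym (+-suc _ _))
... | false | _     = countB-split p q xs

countB-single : {p : A → Bool} {c : A} (xs : List A) → Unique xs → c ∈ xs → p c ≡ true →
  (∀ {x} → p x ≡ true → x ≡ c) → countB p xs ≡ 1
countB-single {p = p} {c} xs uniq c∈ pc only-c =
  trans (countB-as-sum p xs) (trans (sumMap-supportedAt xs uniq c∈ others) (cong (λ b → if b then 1 else 0) pc))
  where
  others : ∀ {x} → x ∈ xs → x ≢ c → (if p x then 1 else 0) ≡ 0
  others {x} _ x≢c with p x in px
  ... | true  = ⊥-elim (x≢c (only-c px))
  ... | false = refl

↭-from-membership : {xs ys : List A} → Unique xs → Unique ys →
  (∀ x → x ∈ xs) → (∀ x → x ∈ ys) → xs ↭ ys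
↭-from-membership uxs uys ∈xs ∈ys =
  ∼bag⇒↭ (unique∧set⇒bag uxs uys (λ {x} → mk⇔ (λ _ → ∈ys x) (λ _ → ∈xs x)))

disjoint-by : {xs ys : List A} (p : A → Bool) →
  (∀ {x} → x ∈ xs → p x ≡ true) → (∀ {y} → y ∈ ys → p y ≡ false) → Disjoint xs ys
disjoint-by p pxs pys (x∈xs , x∈ys) = ≡true⇒≢false (pxs x∈xs) (pys x∈ys)

-- Sums over Boolean functions

module FunctionSums {X : Set} (_≟_ : DecidableEquality X) where

  update : X → Bool → (X → Bool) → X → Bool
  update x b f y = if does (y ≟ x) then b else f y

  update-same : ∀ x b f → update x b f x ≡ b
  update-same x b f with x ≟ x
  ... | yes _  = refl
  ... | no x≢x = ⊥-elim (x≢x refl)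

  update-other : ∀ {x y} b f → y ≢ x → update x b f y ≡ f y
  update-other {x} {y} b f y≢x with y ≟ x
  ... | yes y≡x = ⊥-elim (y≢x y≡x)
  ... | no _    = refl

  update-cong : ∀ x b {f f′} → f ≗ f′ → update x b f ≗ update x b f′
  update-cong x b f≗f′ y with y ≟ x
  ... | yes _ = refl
  ... | no _  = f≗f′ y

  update-comm : ∀ {x y} a b f → x ≢ y → update x a (update y b f) ≗ update y b (update x a f)
  update-comm {x} {y} a b f x≢y z with z ≟ x | z ≟ y
  ... | yes refl | yes refl = ⊥-elim (x≢y refl)
  ... | yes _    | no _     = refl
  ... | no _     | yes _    = refl
  ... | no _     | no _     = refl

  -- F summed over all functions agreeing with g outside xs: one term per Boolean assignment to xs.
  sumOver : List X → ((X → Bool) → ℕ) → (X → Bool) → ℕ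
  sumOver []       F g = F g
  sumOver (x ∷ xs) F g = sumOver xs (F ∘ update x true) g + sumOver xs (F ∘ update x false) g

  Extensional : ((X → Bool) → ℕ) → Set
  Extensional F = F Preserves _≗_ ⟶ _≡_

  update-extensional : ∀ {F} x b → Extensional F → Extensional (F ∘ update x b)
  update-extensional x b ext f≗f′ = ext (update-cong x b f≗f′)

  sumOver-cong-on : (R : (X → Bool) → Set) (xs : List X) {F G : (X → Bool) → ℕ} {g : X → Bool} →
    (∀ {x} b f → x ∈ xs → R f → R (update x b f)) → R g → (∀ f → R f → F f ≡ G f) →
    sumOver xs F g ≡ sumOver xs G g
  sumOver-cong-on R []       pres Rg F≡G = F≡G _ Rg
  sumOver-cong-on R (x ∷ xs) {F} {G} {g} pres Rg F≡G = cong₂ _+_ (branch true) (branch false)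
    where
    branch : ∀ b → sumOver xs (F ∘ update x b) g ≡ sumOver xs (G ∘ update x b) g
    branch b = sumOver-cong-on R xs (λ b′ f x∈ → pres b′ f (there x∈)) Rg
                 (λ f Rf → F≡G _ (pres b f (here refl) Rf))

  sumOver-cong : ∀ xs {F G : (X → Bool) → ℕ} {g} → (∀ f → F f ≡ G f) → sumOver xs F g ≡ sumOver xs G g
  sumOver-cong xs F≡G = sumOver-cong-on (λ _ → ⊤) xs (λ _ _ _ _ → tt) tt (λ f _ → F≡G f)

  sumOver-extensional : ∀ xs {F} → Extensional F → Extensional (sumOver xs F)
  sumOver-extensional []       ext = ext
  sumOver-extensional (x ∷ xs) ext f≗f′ =
    cong₂ _+_ (sumOver-extensional xs (update-extensional x true ext) f≗f′)
              (sumOver-extensional xs (update-extensional x false ext) f≗f′)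

  sumOver-zero : ∀ xs g → sumOver xs (const 0) g ≡ 0
  sumOver-zero []       g = refl
  sumOver-zero (x ∷ xs) g = cong₂ _+_ (sumOver-zero xs g) (sumOver-zero xs g)

  sumOver-+ : ∀ xs (F G : (X → Bool) → ℕ) g →
    sumOver xs (λ f → F f + G f) g ≡ sumOver xs F g + sumOver xs G g
  sumOver-+ []       F G g = refl
  sumOver-+ (x ∷ xs) F G g = begin
    sumOver xs (λ f → F (update x true f) + G (update x true f)) g
      + sumOver xs (λ f → F (update x false f) + G (update x false f)) g
      ≡⟨ cong₂ _+_ (sumOver-+ xs _ _ g) (sumOver-+ xs _ _ g) ⟩
    (sumOver xs (F ∘ update x true) g + sumOver xs (G ∘ update x true) g)
      + (sumOver xs (F ∘ update x false) g + sumOver xs (G ∘ update x false) g)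
      ≡⟨ interchange (S F true) (S G true) (S F false) (S G false) ⟩
    sumOver (x ∷ xs) F g + sumOver (x ∷ xs) G g ∎
    where
    open ≡-Reasoning
    S : ((X → Bool) → ℕ) → Bool → ℕ
    S H b = sumOver xs (H ∘ update x b) g

  sumOver-sumMap : ∀ {A : Set} xs (H : A → (X → Bool) → ℕ) (ys : List A) g →
    sumOver xs (λ f → sumMap (λ a → H a f) ys) g ≡ sumMap (λ a → sumOver xs (H a) g) ys
  sumOver-sumMap xs H []       g = sumOver-zero xs g
  sumOver-sumMap xs H (a ∷ ys) g =
    trans (sumOver-+ xs (H a) _ g) (cong (sumOver xs (H a) g +_) (sumOver-sumMap xs H ys g))

  sumOver-++ : ∀ xs ys F g → sumOver (xs ++ ys) F g ≡ sumOver ys (sumOver xs F) g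
  sumOver-++ []       ys F g = refl
  sumOver-++ (x ∷ xs) ys F g =
    trans (cong₂ _+_ (sumOver-++ xs ys _ g) (sumOver-++ xs ys _ g)) (sym (sumOver-+ ys _ _ g))

  sumOver-↭ : ∀ {F} → Extensional F → ∀ {xs ys} → xs ↭ ys → ∀ g → sumOver xs F g ≡ sumOver ys F g
  sumOver-↭ ext ↭-refl           g = refl
  sumOver-↭ ext (prep x p)       g =
    cong₂ _+_ (sumOver-↭ (update-extensional x true ext) p g) (sumOver-↭ (update-extensional x false ext) p g)
  sumOver-↭ ext (↭-trans p q)    g = trans (sumOver-↭ ext p g) (sumOver-↭ ext q g)
  sumOver-↭ {F} ext (swap {xs} {ys} x y p) g with x ≟ y
  ... | yes refl = cong₂ _+_ (cong₂ _+_ (inner true true) (inner true false))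
                             (cong₂ _+_ (inner false true) (inner false false))
    where
    inner : ∀ a b → sumOver xs (F ∘ update x a ∘ update x b) g ≡ sumOver ys (F ∘ update x a ∘ update x b) g
    inner a b = sumOver-↭ (update-extensional x b (update-extensional x a ext)) p g
  ... | no x≢y = trans (cong₂ _+_ (cong₂ _+_ (inner true true) (inner true false))
                                  (cong₂ _+_ (inner false true) (inner false false)))
                       (interchange (S true true) (S true false) (S false true) (S false false))
    where
    S : Bool → Bool → ℕ
    S a b = sumOver ys (F ∘ update y b ∘ update x a) g
    inner : ∀ a b → sumOver xs (F ∘ update x a ∘ update y b) g ≡ S a b
    inner a b = trans (sumOver-cong xs (λ f → ext (update-comm a b f x≢y)))
                      (sumOver-↭ (update-extensional x a (update-extensional y b ext)) p g)

  agree : List X → (X → Bool) → (X → Bool) → Bool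
  agree xs s f = all (λ x → does (f x Bool.≟ s x)) xs

  agree⇒≡ : ∀ {xs s f x} → agree xs s f ≡ true → x ∈ xs → f x ≡ s x
  agree⇒≡ {s = s} {f} {x} e x∈ with f x Bool.≟ s x | all-elim (λ x → does (f x Bool.≟ s x)) e x∈
  ... | yes fx≡sx | _ = fx≡sx

  ≗⇒agree : ∀ xs {s f} → f ≗ s → agree xs s f ≡ true
  ≗⇒agree xs {s} {f} f≗s = all-intro _ xs (λ {x} _ → dec-true (f x Bool.≟ s x) (f≗s x))

  agree-update : ∀ {x} b s f xs → All (x ≢_) xs → agree xs s (update x b f) ≡ agree xs s f
  agree-update b s f xs x∉ =
    all-cong xs λ y∈ →
      cong (λ c → does (c Bool.≟ _)) (update-other b f (λ y≡x → All-lookup x∉ y∈ (sym y≡x)))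

  sumOver-agree : ∀ xs → Unique xs → (s : X → Bool) (w : ℕ) (g : X → Bool) →
    sumOver xs (λ f → if agree xs s f then w else 0) g ≡ w
  sumOver-agree []       _            s w g = refl
  sumOver-agree (x ∷ xs) (x∉ ∷ uniq) s w g =
    trans (cong₂ _+_ (sumOver-cong xs (split true)) (sumOver-cong xs (split false))) (pick (s x))
    where
    H : (X → Bool) → ℕ
    H f = if agree xs s f then w else 0
    split : ∀ b f → (if agree (x ∷ xs) s (update x b f) then w else 0) ≡ (if does (b Bool.≟ s x) then H f else 0)
    split b f = trans (cong (λ c → if c then w else 0)
                        (cong₂ (λ c d → does (c Bool.≟ s x) ∧ d) (update-same x b f) (agree-update b s f xs x∉)))
                      (Bool.if-∧ (does (b Bool.≟ s x)))
    pick : ∀ c → sumOver xs (λ f → if does (true Bool.≟ c) then H f else 0) g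
                 + sumOver xs (λ f → if does (false Bool.≟ c) then H f else 0) g ≡ w
    pick true  = trans (cong₂ _+_ (sumOver-agree xs uniq s w g) (sumOver-zero xs g)) (+-identityʳ w)
    pick false = cong₂ _+_ (sumOver-zero xs g) (sumOver-agree xs uniq s w g)

module Pullback {X Y : Set} (_≟X_ : DecidableEquality X) (_≟Y_ : DecidableEquality Y)
  (e : Y → X) (back : X → Maybe Y)
  (back-e : ∀ y → back (e y) ≡ just y) (e-back : ∀ x {y} → back x ≡ just y → e y ≡ x) where

  module SX = FunctionSums _≟X_
  module SY = FunctionSums _≟Y_

  glue : (Y → Bool) → (X → Bool) → X → Bool
  glue h g x with back x
  ... | just y  = h y
  ... | nothing = g x

  glue-restrict : ∀ g → glue (g ∘ e) g ≗ g
  glue-restrict g x with back x in eq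
  ... | just y  = cong g (e-back x eq)
  ... | nothing = refl

  glue-e : ∀ h g y → glue h g (e y) ≡ h y
  glue-e h g y rewrite back-e y = refl

  glue-update : ∀ y b h g → SX.update (e y) b (glue h g) ≗ glue (SY.update y b h) g
  glue-update y b h g x with back x in eq
  ... | nothing with x ≟X e y
  ...   | yes refl with () ← trans (sym eq) (back-e y)
  ...   | no _     = refl
  glue-update y b h g x | just y′ with x ≟X e y | y′ ≟Y y
  ... | yes _    | yes _    = refl
  ... | no _     | no _     = refl
  ... | yes refl | no y′≢y  = ⊥-elim (y′≢y (just-injective (trans (sym eq) (back-e y))))
  ... | no x≢ey  | yes refl = ⊥-elim (x≢ey (sym (e-back x eq)))

  sumOver-map : ∀ ys {F} → SX.Extensional F → ∀ g →
    SX.sumOver (map e ys) F g ≡ SY.sumOver ys (λ h → F (glue h g)) (g ∘ e)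
  sumOver-map []       ext g = ext (λ x → sym (glue-restrict g x))
  sumOver-map (y ∷ ys) {F} ext g = cong₂ _+_ (branch true) (branch false)
    where
    branch : ∀ b → SX.sumOver (map e ys) (F ∘ SX.update (e y) b) g
                 ≡ SY.sumOver ys (λ h → F (glue (SY.update y b h) g)) (g ∘ e)
    branch b = trans (sumOver-map ys (SX.update-extensional (e y) b ext) g)
                     (SY.sumOver-cong ys (λ h → ext (glue-update y b h g)))

-- Enumerating Boolean matrices

unsuc : ∀ {m} → Fin (suc m) → Maybe (Fin m)
unsuc fz     = nothing
unsuc (fs i) = just i

unsuc-inverse : ∀ {m} (x : Fin (suc m)) {i} → unsuc x ≡ just i → fs i ≡ x
unsuc-inverse (fs i) refl = refl

module FinSums {m : ℕ} = FunctionSums (Fin._≟_ {m})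

module SucPullback {m : ℕ} = Pullback (Fin._≟_ {suc m}) (Fin._≟_ {m}) fs unsuc (λ _ → refl) unsuc-inverse

allVecs-sum : ∀ m (G : Vec Bool m → ℕ) (g : Fin m → Bool) →
  sumMap G (allVecs m) ≡ FinSums.sumOver (allFin m) (G ∘ Vec.tabulate) g
allVecs-sum zero    G g = +-identityʳ (G Vec.[])
allVecs-sum (suc m) G g = begin
  sumMap G (allVecs (suc m))
    ≡⟨ sumMap-concatMap G (λ b → map (b Vec.∷_) (allVecs m)) (true ∷ false ∷ []) ⟩
  branch true + (branch false + 0)
    ≡⟨ cong (branch true +_) (+-identityʳ (branch false)) ⟩
  branch true + branch false
    ≡⟨ cong₂ _+_ (branch-sum true) (branch-sum false) ⟩
  FinSums.sumOver (allFin (suc m)) (G ∘ Vec.tabulate) g ∎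
  where
  open ≡-Reasoning
  open SucPullback {m}
  branch : Bool → ℕ
  branch b = sumMap G (map (b Vec.∷_) (allVecs m))
  cons≗update : ∀ b h → Vec.tabulate (SX.update fz b (glue h g)) ≡ b Vec.∷ Vec.tabulate h
  cons≗update b h = tabulate-cong pointwise
    where
    pointwise : SX.update fz b (glue h g) ≗ b VecF.∷ h
    pointwise fz     = SX.update-same fz b (glue h g)
    pointwise (fs i) = trans (SX.update-other {fz} {fs i} b (glue h g) (λ ())) (glue-e h g i)
  branch-sum : ∀ b → branch b ≡ SX.sumOver (tabulate fs) (G ∘ Vec.tabulate ∘ SX.update fz b) g
  branch-sum b = begin
    branch b                                         ≡⟨ sumMap-map G (b Vec.∷_) (allVecs m) ⟩
    sumMap (G ∘ (b Vec.∷_)) (allVecs m)             ≡⟨ allVecs-sum m (G ∘ (b Vec.∷_)) (g ∘ fs) ⟩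
    SY.sumOver (allFin m) (G ∘ (b Vec.∷_) ∘ Vec.tabulate) (g ∘ fs)
      ≡⟨ SY.sumOver-cong (allFin m) (λ h → cong G (sym (cons≗update b h))) ⟩
    SY.sumOver (allFin m) (λ h → G (Vec.tabulate (SX.update fz b (glue h g)))) (g ∘ fs)
      ≡⟨ sym (sumOver-map (allFin m) (cong G ∘ tabulate-cong ∘ SX.update-cong fz b) g) ⟩
    SX.sumOver (map fs (allFin m)) (G ∘ Vec.tabulate ∘ SX.update fz b) g
      ≡⟨ cong (λ is → SX.sumOver is (G ∘ Vec.tabulate ∘ SX.update fz b) g) (map-tabulate id fs) ⟩
    SX.sumOver (tabulate fs) (G ∘ Vec.tabulate ∘ SX.update fz b) g ∎

_≟²_ : ∀ {r c} → DecidableEquality (Fin r × Fin c)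
_≟²_ = ≡-dec Fin._≟_ Fin._≟_

cells : (r c : ℕ) → List (Fin r × Fin c)
cells zero    c = []
cells (suc r) c = map (Prod.map₁ fs) (cells r c) ++ map (fz ,_) (allFin c)

toMatrix : ∀ {r c} → (Fin r × Fin c → Bool) → Vec (Vec Bool c) r
toMatrix f = Vec.tabulate (λ i → Vec.tabulate (λ j → f (i , j)))

toMatrix-cong : ∀ {r c} {f f′ : Fin r × Fin c → Bool} → f ≗ f′ → toMatrix f ≡ toMatrix f′
toMatrix-cong f≗f′ = tabulate-cong (λ i → tabulate-cong (λ j → f≗f′ (i , j)))

module CellSums {r c : ℕ} = FunctionSums (_≟²_ {r} {c})

private
  unsucRow : ∀ {r c} → Fin (suc r) × Fin c → Maybe (Fin r × Fin c)
  unsucRow (fz   , j) = nothing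
  unsucRow (fs i , j) = just (i , j)

  firstRow : ∀ {r c} → Fin (suc r) × Fin c → Maybe (Fin c)
  firstRow (fz   , j) = just j
  firstRow (fs i , j) = nothing

  unsucRow-inverse : ∀ {r c} (x : Fin (suc r) × Fin c) {ij} → unsucRow x ≡ just ij → Prod.map₁ fs ij ≡ x
  unsucRow-inverse (fs i , j) refl = refl

  firstRow-inverse : ∀ {r c} (x : Fin (suc r) × Fin c) {j} → firstRow x ≡ just j → (fz , j) ≡ x
  firstRow-inverse (fz , j) refl = refl

module LaterRows {r c : ℕ} =
  Pullback (_≟²_ {suc r} {c}) (_≟²_ {r} {c}) (Prod.map₁ fs) unsucRow (λ _ → refl) unsucRow-inverse

module FirstRow {r c : ℕ} =
  Pullback (_≟²_ {suc r} {c}) (Fin._≟_ {c}) (fz ,_) firstRow (λ _ → refl) firstRow-inverse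

allMats-sum : ∀ r c (G : Vec (Vec Bool c) r → ℕ) (g : Fin r × Fin c → Bool) →
  sumMap G (allMats r c) ≡ CellSums.sumOver (cells r c) (G ∘ toMatrix) g
allMats-sum zero    c G g = +-identityʳ (G Vec.[])
allMats-sum (suc r) c G g = begin
  sumMap G (allMats (suc r) c)
    ≡⟨ sumMap-concatMap G (λ v → map (v Vec.∷_) (allMats r c)) (allVecs c) ⟩
  sumMap (λ v → sumMap G (map (v Vec.∷_) (allMats r c))) (allVecs c)
    ≡⟨ sumMap-cong (allVecs c) (λ {v} _ → trans (sumMap-map G (v Vec.∷_) (allMats r c))
                                              (allMats-sum r c (G ∘ (v Vec.∷_)) (g ∘ Prod.map₁ fs))) ⟩
  sumMap (λ v → CellSums.sumOver (cells r c) (λ f → G (v Vec.∷ toMatrix f)) (g ∘ Prod.map₁ fs)) (allVecs c)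
    ≡⟨ allVecs-sum c _ (g ∘ (fz ,_)) ⟩
  FinSums.sumOver (allFin c) (λ h → CellSums.sumOver (cells r c) (λ f → G (Vec.tabulate h Vec.∷ toMatrix f))
                                                    (g ∘ Prod.map₁ fs)) (g ∘ (fz ,_))
    ≡⟨ FinSums.sumOver-cong (allFin c) (λ h → sym (LaterRows.sumOver-map (cells r c) ext (FirstRow.glue h g))) ⟩
  FinSums.sumOver (allFin c) (λ h → CellSums.sumOver (map (Prod.map₁ fs) (cells r c)) (G ∘ toMatrix)
                                                    (FirstRow.glue h g)) (g ∘ (fz ,_))
    ≡⟨ sym (FirstRow.sumOver-map (allFin c) (CellSums.sumOver-extensional (map (Prod.map₁ fs) (cells r c)) ext) g) ⟩
  CellSums.sumOver (map (fz ,_) (allFin c)) (CellSums.sumOver (map (Prod.map₁ fs) (cells r c)) (G ∘ toMatrix)) g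
    ≡⟨ sym (CellSums.sumOver-++ (map (Prod.map₁ fs) (cells r c)) (map (fz ,_) (allFin c)) (G ∘ toMatrix) g) ⟩
  CellSums.sumOver (cells (suc r) c) (G ∘ toMatrix) g ∎
  where
  open ≡-Reasoning
  ext : CellSums.Extensional (G ∘ toMatrix)
  ext = cong G ∘ toMatrix-cong

∈-cells : ∀ {r c} (ij : Fin r × Fin c) → ij ∈ cells r c
∈-cells {suc r} {c} (fz   , j) = ∈-++⁺ʳ (map (Prod.map₁ fs) (cells r c)) (∈-map⁺ (fz ,_) (∈-allFin j))
∈-cells {suc r} {c} (fs i , j) = ∈-++⁺ˡ (∈-map⁺ (Prod.map₁ fs) (∈-cells (i , j)))

cells-unique : ∀ r c → Unique (cells r c)
cells-unique zero    c = []
cells-unique (suc r) c =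
  Unique.++⁺ (Unique.map⁺ (λ { refl → refl }) (cells-unique r c))
             (Unique.map⁺ (λ { refl → refl }) (Unique.allFin⁺ c))
             (disjoint-by laterRow later first)
  where
  laterRow : Fin (suc r) × Fin c → Bool
  laterRow (fz   , _) = false
  laterRow (fs _ , _) = true
  later : ∀ {ij} → ij ∈ map (Prod.map₁ fs) (cells r c) → laterRow ij ≡ true
  later ij∈ with ∈-map⁻ (Prod.map₁ fs) ij∈
  ... | _ , _ , refl = refl
  first : ∀ {ij} → ij ∈ map (fz ,_) (allFin c) → laterRow ij ≡ false
  first ij∈ with ∈-map⁻ (fz ,_) ij∈
  ... | _ , _ , refl = refl

-- The set ⟨n⟩

_≟E_ : ∀ {n} → DecidableEquality (Elem n)
zer   ≟E zer   = yes refl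
pos i ≟E pos j = map′ (cong pos) (λ { refl → refl }) (i Fin.≟ j)
neg i ≟E neg j = map′ (cong neg) (λ { refl → refl }) (i Fin.≟ j)
zer   ≟E pos _ = no λ ()
zer   ≟E neg _ = no λ ()
pos _ ≟E zer   = no λ ()
pos _ ≟E neg _ = no λ ()
neg _ ≟E zer   = no λ ()
neg _ ≟E pos _ = no λ ()

_≟E²_ : ∀ {n} → DecidableEquality (Elem n × Elem n)
_≟E²_ = ≡-dec _≟E_ _≟E_

∈-elems : ∀ {n} (a : Elem n) → a ∈ elems n
∈-elems     zer     = here refl
∈-elems     (pos i) = there (∈-++⁺ˡ (∈-map⁺ pos (∈-allFin i)))
∈-elems {n} (neg i) = there (∈-++⁺ʳ (map pos (allFin n)) (∈-map⁺ neg (∈-allFin i)))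

isPos : ∀ {n} → Elem n → Bool
isPos (pos _) = true
isPos _       = false

elems-unique : ∀ n → Unique (elems n)
elems-unique n = All.tabulate zer∉ ∷ Unique.++⁺ (Unique.map⁺ (λ { refl → refl }) (Unique.allFin⁺ n))
                                                (Unique.map⁺ (λ { refl → refl }) (Unique.allFin⁺ n))
                                                (disjoint-by isPos pos∈ neg∈)
  where
  zer∉ : ∀ {a} → a ∈ map pos (allFin n) ++ map neg (allFin n) → zer ≢ a
  zer∉ a∈ refl with ∈-++⁻ (map pos (allFin n)) a∈
  ... | inj₁ a∈pos with () ← proj₂ (proj₂ (∈-map⁻ pos a∈pos))
  ... | inj₂ a∈neg with () ← proj₂ (proj₂ (∈-map⁻ neg a∈neg))
  pos∈ : ∀ {a} → a ∈ map pos (allFin n) → isPos a ≡ true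
  pos∈ a∈ with ∈-map⁻ pos a∈
  ... | _ , _ , refl = refl
  neg∈ : ∀ {a} → a ∈ map neg (allFin n) → isPos a ≡ false
  neg∈ a∈ with ∈-map⁻ neg a∈
  ... | _ , _ , refl = refl

fromIdx : ∀ {n} → Fin (size n) → Elem n
fromIdx         fz     = zer
fromIdx {n} (fs k) with splitAt n k
... | inj₁ i = pos i
... | inj₂ i = neg i

fromIdx-idx : ∀ {n} (a : Elem n) → fromIdx (idx a) ≡ a
fromIdx-idx     zer     = refl
fromIdx-idx {n} (pos i) rewrite Fin.splitAt-↑ˡ n i n = refl
fromIdx-idx {n} (neg i) rewrite Fin.splitAt-↑ʳ n n i = refl

idx-fromIdx : ∀ {n} (k : Fin (size n)) → idx (fromIdx {n} k) ≡ k
idx-fromIdx     fz     = refl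
idx-fromIdx {n} (fs k) with splitAt n k in eq
... | inj₁ i = cong fs (Fin.splitAt⁻¹-↑ˡ eq)
... | inj₂ i = cong fs (Fin.splitAt⁻¹-↑ʳ eq)

idx-injective : ∀ {n} {a b : Elem n} → idx a ≡ idx b → a ≡ b
idx-injective {a = a} {b} eq = trans (sym (fromIdx-idx a)) (trans (cong fromIdx eq) (fromIdx-idx b))

key : ∀ {n} → Elem n → ℕ
key = toℕ ∘ idx

key-injective : ∀ {n} {a b : Elem n} → key a ≡ key b → a ≡ b
key-injective = idx-injective ∘ Fin.toℕ-injective

-- i ↦ i + 1, so that ±1 are the new elements of ⟨n+1⟩
shift : ∀ {n} → Elem n → Elem (suc n)
shift zer     = zer
shift (pos i) = pos (fs i)
shift (neg i) = neg (fs i)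

shift-injective : ∀ {n} {a b : Elem n} → shift a ≡ shift b → a ≡ b
shift-injective {a = zer}   {zer}    refl = refl
shift-injective {a = pos i} {pos .i} refl = refl
shift-injective {a = neg i} {neg .i} refl = refl

new⁺ new⁻ : ∀ {n} → Elem (suc n)
new⁺ = pos fz
new⁻ = neg fz

isNew : ∀ {n} → Elem (suc n) → Bool
isNew (pos fz) = true
isNew (neg fz) = true
isNew _        = false

isNew-shift : ∀ {n} (a : Elem n) → isNew (shift a) ≡ false
isNew-shift zer     = refl
isNew-shift (pos i) = refl
isNew-shift (neg i) = refl

negE-shift : ∀ {n} (a : Elem n) → negE (shift a) ≡ shift (negE a)
negE-shift zer     = refl
negE-shift (pos i) = refl
negE-shift (neg i) = refl

negE-involutive : ∀ {n} (a : Elem n) → negE (negE a) ≡ a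
negE-involutive zer     = refl
negE-involutive (pos i) = refl
negE-involutive (neg i) = refl

data View {n : ℕ} : Elem (suc n) → Set where
  fresh⁺  : View new⁺
  fresh⁻  : View new⁻
  shifted : (a : Elem n) → View (shift a)

view : ∀ {n} (x : Elem (suc n)) → View x
view zer          = shifted zer
view (pos fz)     = fresh⁺
view (pos (fs i)) = shifted (pos i)
view (neg fz)     = fresh⁻
view (neg (fs i)) = shifted (neg i)

newPoints : ∀ n → List (Elem (suc n))
newPoints n = new⁺ ∷ new⁻ ∷ []

shiftedPoints : ∀ n → List (Elem (suc n))
shiftedPoints n = map shift (elems n)

newPoints-new : ∀ {n x} → x ∈ newPoints n → isNew x ≡ true
newPoints-new (here refl)         = refl
newPoints-new (there (here refl)) = refl

shiftedPoints-old : ∀ {n x} → x ∈ shiftedPoints n → isNew x ≡ false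
shiftedPoints-old x∈ with ∈-map⁻ shift x∈
... | a , _ , refl = isNew-shift a

newPoints-unique : ∀ n → Unique (newPoints n)
newPoints-unique n = ((λ ()) ∷ []) ∷ [] ∷ []

shiftedPoints-unique : ∀ n → Unique (shiftedPoints n)
shiftedPoints-unique n = Unique.map⁺ shift-injective (elems-unique n)

elems-suc-↭ : ∀ n → elems (suc n) ↭ newPoints n ++ shiftedPoints n
elems-suc-↭ n = ↭-from-membership (elems-unique (suc n)) unique ∈-elems complete
  where
  unique : Unique (newPoints n ++ shiftedPoints n)
  unique = Unique.++⁺ (newPoints-unique n) (shiftedPoints-unique n)
                      (disjoint-by isNew newPoints-new shiftedPoints-old)
  complete : ∀ x → x ∈ newPoints n ++ shiftedPoints n
  complete x with view x
  ... | fresh⁺    = here refl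
  ... | fresh⁻    = there (here refl)
  ... | shifted a = there (there (∈-map⁺ shift (∈-elems a)))

shift² : ∀ {n} → Elem n × Elem n → Elem (suc n) × Elem (suc n)
shift² = Prod.map shift shift

shift²-injective : ∀ {n} {ab cd : Elem n × Elem n} → shift² ab ≡ shift² cd → ab ≡ cd
shift²-injective eq = let a≡c , b≡d = ,-injective eq in cong₂ _,_ (shift-injective a≡c) (shift-injective b≡d)

newPairs : ∀ n → List (Elem (suc n) × Elem (suc n))
newPairs n = cartesianProduct (newPoints n) (elems (suc n)) ++ cartesianProduct (shiftedPoints n) (newPoints n)

pairs : ∀ n → List (Elem n × Elem n)
pairs zero    = (zer , zer) ∷ []
pairs (suc n) = newPairs n ++ map shift² (pairs n)

involvesNew : ∀ {n} → Elem (suc n) × Elem (suc n) → Bool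
involvesNew (x , y) = isNew x ∨ isNew y

involvesNew-shift² : ∀ {n} (ab : Elem n × Elem n) → involvesNew (shift² ab) ≡ false
involvesNew-shift² (a , b) = cong₂ _∨_ (isNew-shift a) (isNew-shift b)

newPairs-involveNew : ∀ {n xy} → xy ∈ newPairs n → involvesNew xy ≡ true
newPairs-involveNew {n} {x , y} xy∈ with ∈-++⁻ (cartesianProduct (newPoints n) (elems (suc n))) xy∈
... | inj₁ xy∈₁ =
  cong (_∨ isNew y) (newPoints-new (proj₁ (∈-cartesianProduct⁻ (newPoints n) (elems (suc n)) xy∈₁)))
... | inj₂ xy∈₂ =
  trans (cong (isNew x ∨_) (newPoints-new (proj₂ (∈-cartesianProduct⁻ (shiftedPoints n) (newPoints n) xy∈₂))))
        (Bool.∨-zeroʳ (isNew x))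

shift²-old : ∀ {n xy} → xy ∈ map shift² (pairs n) → involvesNew xy ≡ false
shift²-old xy∈ with ∈-map⁻ shift² xy∈
... | ab , _ , refl = involvesNew-shift² ab

newPairs-unique : ∀ n → Unique (newPairs n)
newPairs-unique n = Unique.++⁺ (Unique.cartesianProduct⁺ (newPoints-unique n) (elems-unique (suc n)))
                               (Unique.cartesianProduct⁺ (shiftedPoints-unique n) (newPoints-unique n))
                               (disjoint-by (isNew ∘ proj₁) first-new first-old)
  where
  first-new : ∀ {xy} → xy ∈ cartesianProduct (newPoints n) (elems (suc n)) → isNew (proj₁ xy) ≡ true
  first-new xy∈ = newPoints-new (proj₁ (∈-cartesianProduct⁻ (newPoints n) (elems (suc n)) xy∈))
  first-old : ∀ {xy} → xy ∈ cartesianProduct (shiftedPoints n) (newPoints n) → isNew (proj₁ xy) ≡ false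
  first-old xy∈ = shiftedPoints-old (proj₁ (∈-cartesianProduct⁻ (shiftedPoints n) (newPoints n) xy∈))

pairs-unique : ∀ n → Unique (pairs n)
pairs-unique zero    = [] ∷ []
pairs-unique (suc n) = Unique.++⁺ (newPairs-unique n) (Unique.map⁺ shift²-injective (pairs-unique n))
                                  (disjoint-by involvesNew newPairs-involveNew shift²-old)

∈-pairs-newFirst : ∀ {n x} y → x ∈ newPoints n → (x , y) ∈ pairs (suc n)
∈-pairs-newFirst {n} y x∈ =
  ∈-++⁺ˡ (∈-++⁺ˡ {ys = cartesianProduct (shiftedPoints n) (newPoints n)}
    (∈-cartesianProduct⁺ {xs = newPoints n} {ys = elems (suc n)} x∈ (∈-elems y)))

∈-pairs-newSecond : ∀ {n y} a → y ∈ newPoints n → (shift a , y) ∈ pairs (suc n)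
∈-pairs-newSecond {n} a y∈ =
  ∈-++⁺ˡ (∈-++⁺ʳ (cartesianProduct (newPoints n) (elems (suc n)))
    (∈-cartesianProduct⁺ {xs = shiftedPoints n} {ys = newPoints n} (∈-map⁺ shift (∈-elems a)) y∈))

∈-pairs : ∀ {n} (xy : Elem n × Elem n) → xy ∈ pairs n
∈-pairs {zero}  (zer , zer) = here refl
∈-pairs {suc n} (x , y) with view x | view y
... | fresh⁺    | _         = ∈-pairs-newFirst y (here refl)
... | fresh⁻    | _         = ∈-pairs-newFirst y (there (here refl))
... | shifted a | fresh⁺    = ∈-pairs-newSecond a (here refl)
... | shifted a | fresh⁻    = ∈-pairs-newSecond a (there (here refl))
... | shifted a | shifted b = ∈-++⁺ʳ (newPairs n) (∈-map⁺ shift² (∈-pairs (a , b)))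

unshift : ∀ {n} → Elem (suc n) → Maybe (Elem n)
unshift zer          = just zer
unshift (pos fz)     = nothing
unshift (pos (fs i)) = just (pos i)
unshift (neg fz)     = nothing
unshift (neg (fs i)) = just (neg i)

unshift-shift : ∀ {n} (a : Elem n) → unshift (shift a) ≡ just a
unshift-shift zer     = refl
unshift-shift (pos i) = refl
unshift-shift (neg i) = refl

shift-unshift : ∀ {n} {x : Elem (suc n)} {a} → unshift x ≡ just a → shift a ≡ x
shift-unshift {x = zer}        refl = refl
shift-unshift {x = pos (fs i)} refl = refl
shift-unshift {x = neg (fs i)} refl = refl

unshift² : ∀ {n} → Elem (suc n) × Elem (suc n) → Maybe (Elem n × Elem n)
unshift² (x , y) = zip (unshift x) (unshift y)

shift²-unshift² : ∀ {n} (xy : Elem (suc n) × Elem (suc n)) {ab} → unshift² xy ≡ just ab → shift² ab ≡ xy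
shift²-unshift² (x , y) eq with unshift x in ex | unshift y in ey
shift²-unshift² _ refl | just a | just b = cong₂ _,_ (shift-unshift ex) (shift-unshift ey)

unshift²-shift² : ∀ {n} (ab : Elem n × Elem n) → unshift² (shift² ab) ≡ just ab
unshift²-shift² (a , b) = cong₂ zip (unshift-shift a) (unshift-shift b)

module ShiftPullback {n : ℕ} =
  Pullback (_≟E²_ {suc n}) (_≟E²_ {n}) shift² unshift² unshift²-shift² shift²-unshift²

-- Relations on ⟨n⟩

Relᵇ : ℕ → Set
Relᵇ n = Elem n × Elem n → Bool

isZero : ∀ {n} → Elem n → Bool
isZero zer = true
isZero _   = false

module _ {n : ℕ} (f : Relᵇ n) where
  private
    E : List (Elem n)
    E = elems n

  reflexiveᵇ symmetricᵇ transitiveᵇ negationᵇ selfNegativeᵇ : Bool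
  reflexiveᵇ    = all (λ a → f (a , a)) E
  symmetricᵇ    = all (λ a → all (λ b → f (a , b) ⇒ᵇ f (b , a)) E) E
  transitiveᵇ   = all (λ a → all (λ b → all (λ c → (f (a , b) ∧ f (b , c)) ⇒ᵇ f (a , c)) E) E) E
  negationᵇ     = all (λ a → all (λ b → f (a , b) ⇒ᵇ f (negE a , negE b)) E) E
  selfNegativeᵇ = all (λ a → f (a , negE a) ⇒ᵇ f (a , zer)) E

  typeBᵇ : Bool
  typeBᵇ = (reflexiveᵇ ∧ symmetricᵇ ∧ transitiveᵇ) ∧ negationᵇ ∧ selfNegativeᵇ

  isClassMin : Elem n → Bool
  isClassMin a = all (λ b → f (a , b) ⇒ᵇ (key a ≤ᵇ key b)) E

  classCount : ℕ
  classCount = countB isClassMin E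

  noZeroᵇ successionᵇ separatedᵇ : Bool
  noZeroᵇ     = all (λ a → f (a , zer) ⇒ᵇ isZero a) E
  successionᵇ = any (λ i → any (λ j → (toℕ j ≡ᵇ suc (toℕ i)) ∧ f (pos i , pos j)) (allFin n)) (allFin n)
  separatedᵇ  = typeBᵇ ∧ noZeroᵇ ∧ not successionᵇ

separatedᵇ-rel : ∀ {n} (R : BRel n) → isSeparatedNoZero R ≡ separatedᵇ (uncurry (rel R))
separatedᵇ-rel {n} R = cong (λ b → isTypeB R ∧ b ∧ not (hasSuccession R))
  (all-cong (elems n) λ { {zer} _ → refl ; {pos i} _ → refl ; {neg i} _ → refl })

module _ {n : ℕ} where

  allElems-elim : {p : Elem n → Bool} → all p (elems n) ≡ true → ∀ a → p a ≡ true
  allElems-elim e a = all-elim _ e (∈-elems a)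

  allElems-intro : {p : Elem n → Bool} → (∀ a → p a ≡ true) → all p (elems n) ≡ true
  allElems-intro h = all-intro _ (elems n) (λ {a} _ → h a)

  allElems-cong : {p q : Elem n → Bool} → (∀ a → p a ≡ q a) → all p (elems n) ≡ all q (elems n)
  allElems-cong h = all-cong (elems n) (λ {a} _ → h a)

record IsTypeB {n : ℕ} (f : Relᵇ n) : Set where
  field
    reflexive    : ∀ a → f (a , a) ≡ true
    symmetric    : ∀ a b → f (a , b) ≡ true → f (b , a) ≡ true
    transitive   : ∀ a b c → f (a , b) ≡ true → f (b , c) ≡ true → f (a , c) ≡ true
    negation     : ∀ a b → f (a , b) ≡ true → f (negE a , negE b) ≡ true
    selfNegative : ∀ a → f (a , negE a) ≡ true → f (a , zer) ≡ true

record IsSeparated {n : ℕ} (f : Relᵇ n) : Set where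
  field
    typeB         : IsTypeB f
    zeroAlone     : ∀ a → f (a , zer) ≡ true → a ≡ zer
    noSuccession  : ∀ i j → (toℕ j ≡ᵇ suc (toℕ i)) ≡ true → f (pos i , pos j) ≡ false

module _ {n : ℕ} {f : Relᵇ n} where

  typeBᵇ-sound : typeBᵇ f ≡ true → IsTypeB f
  typeBᵇ-sound h = record
    { reflexive    = allElems-elim isRefl
    ; symmetric    = λ a b → ⇒ᵇ-elim (allElems-elim (allElems-elim isSym a) b)
    ; transitive   = λ a b c ab bc →
        ⇒ᵇ-elim (allElems-elim (allElems-elim (allElems-elim isTrans a) b) c) (∧-true ab bc)
    ; negation     = λ a b → ⇒ᵇ-elim (allElems-elim (allElems-elim isNeg a) b)
    ; selfNegative = λ a → ⇒ᵇ-elim (allElems-elim isSelfNeg a)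
    }
    where
    isEquiv′ : (reflexiveᵇ f ∧ symmetricᵇ f ∧ transitiveᵇ f) ≡ true
    isEquiv′ = ∧-trueˡ h
    isRefl : reflexiveᵇ f ≡ true
    isRefl = ∧-trueˡ isEquiv′
    isSym : symmetricᵇ f ≡ true
    isSym = ∧-trueˡ (∧-trueʳ {reflexiveᵇ f} isEquiv′)
    isTrans : transitiveᵇ f ≡ true
    isTrans = ∧-trueʳ {symmetricᵇ f} (∧-trueʳ {reflexiveᵇ f} isEquiv′)
    isNeg : negationᵇ f ≡ true
    isNeg = ∧-trueˡ (∧-trueʳ {reflexiveᵇ f ∧ symmetricᵇ f ∧ transitiveᵇ f} h)
    isSelfNeg : selfNegativeᵇ f ≡ true
    isSelfNeg = ∧-trueʳ {negationᵇ f} (∧-trueʳ {reflexiveᵇ f ∧ symmetricᵇ f ∧ transitiveᵇ f} h)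

  typeBᵇ-complete : IsTypeB f → typeBᵇ f ≡ true
  typeBᵇ-complete t =
    ∧-true (∧-true (allElems-intro reflexive)
                   (∧-true (allElems-intro λ a → allElems-intro λ b → ⇒ᵇ-intro (symmetric a b))
                           (allElems-intro λ a → allElems-intro λ b → allElems-intro λ c →
                              ⇒ᵇ-intro λ abc → transitive a b c (∧-trueˡ abc) (∧-trueʳ abc))))
           (∧-true (allElems-intro λ a → allElems-intro λ b → ⇒ᵇ-intro (negation a b))
                   (allElems-intro λ a → ⇒ᵇ-intro (selfNegative a)))
    where open IsTypeB t

  separatedᵇ-sound : separatedᵇ f ≡ true → IsSeparated f
  separatedᵇ-sound h = record
    { typeB        = typeBᵇ-sound (∧-trueˡ h)
    ; zeroAlone    = λ a → isZero⇒≡ a ∘ ⇒ᵇ-elim (allElems-elim (∧-trueˡ {noZeroᵇ f} rest) a)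
    ; noSuccession = λ i j j≡i+1 → Bool.¬-not λ fij → ≡true⇒≢false
        (any-intro _ (allFin n) (∈-allFin i) (any-intro _ (allFin n) (∈-allFin j) (∧-true j≡i+1 fij)))
        (Bool.not-injective (∧-trueʳ {noZeroᵇ f} rest))
    }
    where
    rest : (noZeroᵇ f ∧ not (successionᵇ f)) ≡ true
    rest = ∧-trueʳ {typeBᵇ f} h
    isZero⇒≡ : ∀ a → isZero a ≡ true → a ≡ zer
    isZero⇒≡ zer _ = refl

  separatedᵇ-complete : IsSeparated f → separatedᵇ f ≡ true
  separatedᵇ-complete s =
    ∧-true (typeBᵇ-complete typeB)
           (∧-true (allElems-intro λ a → ⇒ᵇ-intro λ a∼0 →
                      subst (λ x → isZero x ≡ true) (sym (zeroAlone a a∼0)) refl)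
                   (cong not (any-false-intro _ (allFin n) λ {i} _ →
                                any-false-intro _ (allFin n) λ {j} _ → noSucc i j)))
    where
    open IsSeparated s
    noSucc : ∀ i j → ((toℕ j ≡ᵇ suc (toℕ i)) ∧ f (pos i , pos j)) ≡ false
    noSucc i j with toℕ j ≡ᵇ suc (toℕ i) in j≡i+1
    ... | true  = noSuccession i j j≡i+1
    ... | false = refl

module _ {n : ℕ} {f f′ : Relᵇ n} (f≗f′ : f ≗ f′) where

  typeBᵇ-cong : typeBᵇ f ≡ typeBᵇ f′
  typeBᵇ-cong =
    cong₂ _∧_ (cong₂ _∧_ (allElems-cong λ a → f≗f′ (a , a))
                         (cong₂ _∧_ (allElems-cong λ a → allElems-cong λ b → ⇒ᵇ-cong (a , b) (b , a))
                                    (allElems-cong λ a → allElems-cong λ b → allElems-cong λ c →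
                                       cong₂ _⇒ᵇ_ (cong₂ _∧_ (f≗f′ (a , b)) (f≗f′ (b , c))) (f≗f′ (a , c)))))
              (cong₂ _∧_ (allElems-cong λ a → allElems-cong λ b → ⇒ᵇ-cong (a , b) (negE a , negE b))
                         (allElems-cong λ a → ⇒ᵇ-cong (a , negE a) (a , zer)))
    where
    ⇒ᵇ-cong : ∀ x y → (f x ⇒ᵇ f y) ≡ (f′ x ⇒ᵇ f′ y)
    ⇒ᵇ-cong x y = cong₂ _⇒ᵇ_ (f≗f′ x) (f≗f′ y)

  classCount-cong : classCount f ≡ classCount f′
  classCount-cong =
    countB-cong (elems n) λ {a} _ → allElems-cong λ b → cong (_⇒ᵇ (key a ≤ᵇ key b)) (f≗f′ (a , b))

  separatedᵇ-cong : separatedᵇ f ≡ separatedᵇ f′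
  separatedᵇ-cong =
    cong₂ _∧_ typeBᵇ-cong
      (cong₂ _∧_ (allElems-cong λ a → cong (_⇒ᵇ isZero a) (f≗f′ (a , zer)))
                 (cong not (any-cong (allFin n) λ {i} _ → any-cong (allFin n) λ {j} _ →
                              cong ((toℕ j ≡ᵇ suc (toℕ i)) ∧_) (f≗f′ (pos i , pos j)))))

  IsTypeB-≗ : IsTypeB f → IsTypeB f′
  IsTypeB-≗ t = typeBᵇ-sound (trans (sym typeBᵇ-cong) (typeBᵇ-complete t))

  IsSeparated-≗ : IsSeparated f → IsSeparated f′
  IsSeparated-≗ s = separatedᵇ-sound (trans (sym separatedᵇ-cong) (separatedᵇ-complete s))

transport-rel : ∀ {n} (f : Relᵇ n) {a a′ b b′} → a ≡ a′ → b ≡ b′ → f (a , b) ≡ true → f (a′ , b′) ≡ true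
transport-rel f refl refl fab = fab

module _ {n : ℕ} {f : Relᵇ (suc n)} where

  IsTypeB-restrict : IsTypeB f → IsTypeB (f ∘ shift²)
  IsTypeB-restrict t = record
    { reflexive    = reflexive ∘ shift
    ; symmetric    = λ a b → symmetric (shift a) (shift b)
    ; transitive   = λ a b c → transitive (shift a) (shift b) (shift c)
    ; negation     = λ a b → transport-rel f (negE-shift a) (negE-shift b) ∘ negation (shift a) (shift b)
    ; selfNegative = λ a → selfNegative (shift a) ∘ transport-rel f refl (sym (negE-shift a))
    }
    where open IsTypeB t

  IsSeparated-restrict : IsSeparated f → IsSeparated (f ∘ shift²)
  IsSeparated-restrict s = record
    { typeB        = IsTypeB-restrict typeB
    ; zeroAlone    = λ a → shift-injective ∘ zeroAlone (shift a)
    ; noSuccession = λ i j → noSuccession (fs i) (fs j)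
    }
    where open IsSeparated s

  typeBᵇ-restrict : ∀ {h} → f ∘ shift² ≗ h → typeBᵇ f ≡ true → typeBᵇ h ≡ true
  typeBᵇ-restrict f≗h = typeBᵇ-complete ∘ IsTypeB-≗ f≗h ∘ IsTypeB-restrict ∘ typeBᵇ-sound {f = f}

  separatedᵇ-restrict : ∀ {h} → f ∘ shift² ≗ h → separatedᵇ f ≡ true → separatedᵇ h ≡ true
  separatedᵇ-restrict f≗h = separatedᵇ-complete ∘ IsSeparated-≗ f≗h ∘ IsSeparated-restrict ∘ separatedᵇ-sound {f = f}

module PairSums {n : ℕ} = FunctionSums (_≟E²_ {n})

idx² : ∀ {n} → Elem n × Elem n → Fin (size n) × Fin (size n)
idx² = Prod.map idx idx

fromIdx² : ∀ {n} → Fin (size n) × Fin (size n) → Elem n × Elem n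
fromIdx² = Prod.map fromIdx fromIdx

fromIdx²-idx² : ∀ {n} (ab : Elem n × Elem n) → fromIdx² (idx² ab) ≡ ab
fromIdx²-idx² (a , b) = cong₂ _,_ (fromIdx-idx a) (fromIdx-idx b)

idx²-fromIdx² : ∀ {n} (ij : Fin (size n) × Fin (size n)) → idx² (fromIdx² {n} ij) ≡ ij
idx²-fromIdx² (i , j) = cong₂ _,_ (idx-fromIdx i) (idx-fromIdx j)

fromIdx²-inverse : ∀ {n} (ij : Fin (size n) × Fin (size n)) {ab} → just (fromIdx² {n} ij) ≡ just ab → idx² ab ≡ ij
fromIdx²-inverse {n} ij refl = idx²-fromIdx² {n} ij

module IdxPullback {n : ℕ} = Pullback (_≟²_ {size n} {size n}) (_≟E²_ {n}) idx² (just ∘ fromIdx²)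
  (cong just ∘ fromIdx²-idx²) (fromIdx²-inverse {n})

cells↭idx²-pairs : ∀ n → cells (size n) (size n) ↭ map idx² (pairs n)
cells↭idx²-pairs n = ↭-from-membership (cells-unique (size n) (size n))
  (Unique.map⁺ (λ eq → let a≡c , b≡d = ,-injective eq in cong₂ _,_ (idx-injective a≡c) (idx-injective b≡d))
               (pairs-unique n))
  ∈-cells
  (λ { (i , j) → subst (_∈ map idx² (pairs n)) (cong₂ _,_ (idx-fromIdx i) (idx-fromIdx j))
                       (∈-map⁺ idx² (∈-pairs (fromIdx i , fromIdx j))) })

relations-sum : ∀ n (W : Relᵇ n → ℕ) → PairSums.Extensional W →
  sumMap (W ∘ uncurry ∘ rel) (allRels n) ≡ PairSums.sumOver (pairs n) W (const false)
relations-sum n W ext = begin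
  sumMap (W ∘ uncurry ∘ rel) (allRels n)
    ≡⟨ sumMap-map (W ∘ uncurry ∘ rel) mkRel (allMats s s) ⟩
  sumMap (W ∘ uncurry ∘ rel ∘ mkRel) (allMats s s)
    ≡⟨ allMats-sum s s _ (const false) ⟩
  CellSums.sumOver (cells s s) (W ∘ uncurry ∘ rel ∘ mkRel ∘ toMatrix) (const false)
    ≡⟨ CellSums.sumOver-cong (cells s s) (λ f → ext (lookup-toMatrix f)) ⟩
  CellSums.sumOver (cells s s) (λ f → W (f ∘ idx²)) (const false)
    ≡⟨ CellSums.sumOver-↭ (λ f≗f′ → ext (f≗f′ ∘ idx²)) (cells↭idx²-pairs n) (const false) ⟩
  CellSums.sumOver (map idx² (pairs n)) (λ f → W (f ∘ idx²)) (const false)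
    ≡⟨ IdxPullback.sumOver-map (pairs n) (λ f≗f′ → ext (f≗f′ ∘ idx²)) (const false) ⟩
  PairSums.sumOver (pairs n) (λ h → W (IdxPullback.glue h (const false) ∘ idx²)) (const false)
    ≡⟨ PairSums.sumOver-cong (pairs n) (λ h → ext (IdxPullback.glue-e h (const false))) ⟩
  PairSums.sumOver (pairs n) W (const false) ∎
  where
  open ≡-Reasoning
  s : ℕ
  s = size n
  lookup-toMatrix : ∀ f → uncurry (rel (mkRel (toMatrix f))) ≗ f ∘ idx²
  lookup-toMatrix f (a , b) =
    trans (cong (λ row → Vec.lookup row (idx b)) (lookup∘tabulate (λ i → Vec.tabulate (λ j → f (i , j))) (idx a)))
          (lookup∘tabulate (λ j → f (idx a , j)) (idx b))

-- Counting classes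

≤⇒≤ᵇ≡true : ∀ {m n} → m ≤ n → (m ≤ᵇ n) ≡ true
≤⇒≤ᵇ≡true m≤n = Equivalence.to Bool.T-≡ (≤⇒≤ᵇ m≤n)

≤ᵇ≡true⇒≤ : ∀ {m n} → (m ≤ᵇ n) ≡ true → m ≤ n
≤ᵇ≡true⇒≤ {m} {n} e = ≤ᵇ⇒≤ m n (Equivalence.from Bool.T-≡ e)

≤ᵇ≡false⇒> : ∀ {m n} → (m ≤ᵇ n) ≡ false → n < m
≤ᵇ≡false⇒> m≰ᵇn = ≰⇒> (λ m≤n → ≡true⇒≢false (≤⇒≤ᵇ≡true m≤n) m≰ᵇn)

>⇒≤ᵇ≡false : ∀ {m n} → n < m → (m ≤ᵇ n) ≡ false
>⇒≤ᵇ≡false n<m = Bool.¬-not (<⇒≱ n<m ∘ ≤ᵇ≡true⇒≤)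

-- For an equivalence relation R: the number of classes meeting xs, each counted at its last element.
classesIn : (A × A → Bool) → List A → ℕ
classesIn R []       = 0
classesIn R (x ∷ xs) = if any (λ y → R (x , y)) xs then classesIn R xs else suc (classesIn R xs)

classesIn-cong : {R R′ : A × A → Bool} → R ≗ R′ → ∀ xs → classesIn R xs ≡ classesIn R′ xs
classesIn-cong R≗R′ []       = refl
classesIn-cong {R = R} {R′} R≗R′ (x ∷ xs)
  rewrite classesIn-cong R≗R′ xs
        | any-cong {p = λ y → R (x , y)} {q = λ y → R′ (x , y)} xs (λ {y} _ → R≗R′ (x , y))
  = refl

classesIn-map : (R : B × B → Bool) (e : A → B) (xs : List A) →
  classesIn R (map e xs) ≡ classesIn (R ∘ Prod.map e e) xs
classesIn-map R e []       = refl
classesIn-map R e (x ∷ xs) rewrite classesIn-map R e xs | any-map (λ y → R (e x , y)) e xs = refl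

module ClassCounting {A : Set} (R : A × A → Bool)
  (symmetric  : ∀ a b → R (a , b) ≡ true → R (b , a) ≡ true)
  (transitive : ∀ a b c → R (a , b) ≡ true → R (b , c) ≡ true → R (a , c) ≡ true) where

  related⇒same : ∀ {x y} → R (x , y) ≡ true → ∀ z → R (y , z) ≡ R (x , z)
  related⇒same {x} {y} xy z = Bool.⇔→≡ (mk⇔ (transitive x y z xy) (transitive y x z (symmetric x y xy)))

  classesIn-↭ : ∀ {xs ys} → xs ↭ ys → classesIn R xs ≡ classesIn R ys
  classesIn-↭ ↭-refl = refl
  classesIn-↭ (prep x p) rewrite any-↭ (λ y → R (x , y)) p | classesIn-↭ p = refl
  classesIn-↭ (↭-trans p q) = trans (classesIn-↭ p) (classesIn-↭ q)
  classesIn-↭ (swap {xs} {ys} x y p) with R (x , y) in xy | R (y , x) in yx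
  ... | true  | false = ⊥-elim (≡true⇒≢false (symmetric x y xy) yx)
  ... | false | true  = ⊥-elim (≡true⇒≢false (symmetric y x yx) xy)
  ... | true  | true
    rewrite any-cong {p = λ z → R (y , z)} {q = λ z → R (x , z)} xs (λ {z} _ → related⇒same xy z)
          | any-↭ (λ z → R (x , z)) p | classesIn-↭ p = refl
  ... | false | false
    rewrite any-↭ (λ z → R (x , z)) p | any-↭ (λ z → R (y , z)) p | classesIn-↭ p
    with any (λ z → R (x , z)) ys | any (λ z → R (y , z)) ys
  ... | true  | true  = refl
  ... | true  | false = refl
  ... | false | true  = refl
  ... | false | false = refl

  module _ (k : A → ℕ) (k-injective : ∀ {a b} → k a ≡ k b → a ≡ b) where

    isMinIn : List A → A → Bool
    isMinIn xs a = all (λ b → R (a , b) ⇒ᵇ (k a ≤ᵇ k b)) xs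

    extractMax : ∀ x xs →
      Σ A λ m → Σ (List A) λ ys → (x ∷ xs ↭ m ∷ ys) × (∀ {y} → y ∈ x ∷ xs → k y ≤ k m)
    extractMax x []       = x , [] , ↭-refl , λ { (here refl) → ≤-refl }
    extractMax x (z ∷ zs) with extractMax z zs
    ... | m , ys , p , max with k x ≤ᵇ k m in x≤m
    ...   | true  = m , x ∷ ys , ↭-trans (prep x p) (swap x m ↭-refl) ,
                    λ { (here refl) → ≤ᵇ≡true⇒≤ x≤m ; (there y∈) → max y∈ }
    ...   | false = x , z ∷ zs , ↭-refl ,
                    λ { (here refl) → ≤-refl ; (there y∈) → ≤-trans (max y∈) (<⇒≤ (≤ᵇ≡false⇒> x≤m)) }

    isMinIn-max : ∀ {m ys} → (∀ {y} → y ∈ ys → k y < k m) →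
      isMinIn (m ∷ ys) m ≡ not (any (λ y → R (m , y)) ys)
    isMinIn-max {m} {ys} below =
      trans (cong (_∧ isMinIn ys m) (⇒ᵇ-intro {R (m , m)} λ _ → ≤⇒≤ᵇ≡true (≤-refl {k m}))) (others ys below)
      where
      others : ∀ ys → (∀ {y} → y ∈ ys → k y < k m) → isMinIn ys m ≡ not (any (λ y → R (m , y)) ys)
      others []       _     = refl
      others (y ∷ ys) below with R (m , y)
      ... | true  = cong (_∧ isMinIn ys m) (>⇒≤ᵇ≡false (below (here refl)))
      ... | false = others ys (below ∘ there)

    isMinIn-below-max : ∀ {m ys y} → k y ≤ k m → isMinIn (m ∷ ys) y ≡ isMinIn ys y
    isMinIn-below-max {m} {ys} {y} y≤m = cong (_∧ isMinIn ys y) (⇒ᵇ-intro {R (y , m)} λ _ → ≤⇒≤ᵇ≡true y≤m)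

    -- The element of largest key is minimal exactly when no other element is related to it, and it does
    -- not affect the minimality of the others; remove it and recurse.
    countMin≡classesIn : ∀ xs → Unique xs → countB (isMinIn xs) xs ≡ classesIn R xs
    countMin≡classesIn xs = byLength (length xs) xs refl
      where
      open PermutationProperties (setoid A) using (Unique-resp-↭)
      byLength : ∀ ℓ xs → length xs ≡ ℓ → Unique xs → countB (isMinIn xs) xs ≡ classesIn R xs
      byLength _       []       _   _    = refl
      byLength (suc ℓ) (x ∷ xs) len uniq with extractMax x xs
      ... | m , ys , p , max with Unique-resp-↭ (↭⇒↭ₛ p) uniq
      ...   | m∉ys ∷ ys-unique = begin
        countB (isMinIn (x ∷ xs)) (x ∷ xs) ≡⟨ countB-↭ _ p ⟩
        countB (isMinIn (x ∷ xs)) (m ∷ ys) ≡⟨ countB-cong (m ∷ ys) (λ _ → all-↭ _ p) ⟩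
        countB (isMinIn (m ∷ ys)) (m ∷ ys) ≡⟨ maxFirst ⟩
        classesIn R (m ∷ ys)               ≡⟨ classesIn-↭ (↭-sym p) ⟩
        classesIn R (x ∷ xs)               ∎
        where
        open ≡-Reasoning
        below : ∀ {y} → y ∈ ys → k y < k m
        below y∈ = ≤∧≢⇒< (max (∈-resp-↭ (↭-sym p) (there y∈)))
                         (λ ky≡km → All-lookup m∉ys y∈ (sym (k-injective ky≡km)))
        rest : countB (isMinIn (m ∷ ys)) ys ≡ classesIn R ys
        rest = trans (countB-cong ys (λ y∈ → isMinIn-below-max {ys = ys} (<⇒≤ (below y∈))))
                     (byLength ℓ ys (cong pred (trans (sym (↭-length p)) len)) ys-unique)
        maxFirst : countB (isMinIn (m ∷ ys)) (m ∷ ys) ≡ classesIn R (m ∷ ys)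
        maxFirst rewrite isMinIn-max below | rest with any (λ y → R (m , y)) ys
        ... | true  = refl
        ... | false = refl

zer-isClassMin : ∀ {n} (h : Relᵇ n) → isClassMin h zer ≡ true
zer-isClassMin h = allElems-intro λ b → ⇒ᵇ-intro {h (zer , b)} λ _ → refl

module _ {n : ℕ} {h : Relᵇ n} (t : IsTypeB h) where
  open IsTypeB t

  classCount≡classesIn : classCount h ≡ classesIn h (elems n)
  classCount≡classesIn =
    ClassCounting.countMin≡classesIn h symmetric transitive key key-injective (elems n) (elems-unique n)

  classMin-exists : ∀ y → Σ (Elem n) λ a → isClassMin h a ≡ true × h (a , y) ≡ true
  classMin-exists y = below (suc (key y)) y ≤-refl
    where
    below : ∀ bound y → key y < bound → Σ (Elem n) λ a → isClassMin h a ≡ true × h (a , y) ≡ true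
    below (suc bound) y y<bound with isClassMin h y in min
    ... | true  = y , min , reflexive y
    ... | false with all-false-witness _ (elems n) min
    ...   | b , _ , not-min with ⇒ᵇ-false {h (y , b)} not-min
    ...     | hyb , y≰b with below bound b (≤-trans (≤ᵇ≡false⇒> y≰b) (s≤s⁻¹ y<bound))
    ...       | a , a-min , hab = a , a-min , transitive a b y hab (symmetric y b hyb)

  classMin-unique : ∀ {a b} → isClassMin h a ≡ true → isClassMin h b ≡ true → h (a , b) ≡ true → a ≡ b
  classMin-unique {a} {b} a-min b-min hab = key-injective (≤-antisym
    (≤ᵇ≡true⇒≤ (⇒ᵇ-elim (allElems-elim a-min b) hab))
    (≤ᵇ≡true⇒≤ (⇒ᵇ-elim (allElems-elim b-min a) (symmetric a b hab))))

module _ {n : ℕ} {f : Relᵇ (suc n)} (t : IsTypeB f) where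
  open IsTypeB t

  classCount-newFirst : classCount f ≡ classesIn f (newPoints n ++ shiftedPoints n)
  classCount-newFirst =
    trans (classCount≡classesIn t) (ClassCounting.classesIn-↭ f symmetric transitive (elems-suc-↭ n))

  classesIn-shifted : ∀ {h} → f ∘ shift² ≗ h → classesIn f (shiftedPoints n) ≡ classesIn h (elems n)
  classesIn-shifted f≗h = trans (classesIn-map f shift (elems n)) (classesIn-cong f≗h (elems n))

-- One-point extensions

collapse : ∀ {n} → Elem n → Elem (suc n) → Elem n
collapse a zer          = zer
collapse a (pos fz)     = a
collapse a (pos (fs i)) = pos i
collapse a (neg fz)     = negE a
collapse a (neg (fs i)) = neg i

collapse-shift : ∀ {n} (a b : Elem n) → collapse a (shift b) ≡ b
collapse-shift a zer     = refl
collapse-shift a (pos i) = refl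
collapse-shift a (neg i) = refl

collapse-negE : ∀ {n} (a : Elem n) x → collapse a (negE x) ≡ negE (collapse a x)
collapse-negE a zer          = refl
collapse-negE a (pos fz)     = refl
collapse-negE a (pos (fs i)) = refl
collapse-negE a (neg fz)     = sym (negE-involutive a)
collapse-negE a (neg (fs i)) = refl

joinClass : ∀ {n} → Relᵇ n → Elem n → Relᵇ (suc n)
joinClass h a (x , y) = h (collapse a x , collapse a y)

joinClass-restrict : ∀ {n} (h : Relᵇ n) a → joinClass h a ∘ shift² ≗ h
joinClass-restrict h a (b , c) = cong₂ (λ x y → h (x , y)) (collapse-shift a b) (collapse-shift a c)

joinClass-joined : ∀ {n} (h : Relᵇ n) a b → joinClass h a (new⁺ , shift b) ≡ h (a , b)
joinClass-joined h a b = cong (λ y → h (a , y)) (collapse-shift a b)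

IsTypeB-joinClass : ∀ {n} {h : Relᵇ n} → IsTypeB h → ∀ a → IsTypeB (joinClass h a)
IsTypeB-joinClass {h = h} t a = record
  { reflexive    = reflexive ∘ collapse a
  ; symmetric    = λ x y → symmetric (collapse a x) (collapse a y)
  ; transitive   = λ x y z → transitive (collapse a x) (collapse a y) (collapse a z)
  ; negation     = λ x y → transport-rel h (sym (collapse-negE a x)) (sym (collapse-negE a y))
                             ∘ negation (collapse a x) (collapse a y)
  ; selfNegative = λ x → selfNegative (collapse a x) ∘ transport-rel h refl (collapse-negE a x)
  }
  where open IsTypeB t

data Point (n : ℕ) : Set where
  old           : Elem n → Point n
  newPos newNeg : Point n

point : ∀ {n} → Elem (suc n) → Point n
point zer          = old zer
point (pos fz)     = newPos
point (pos (fs i)) = old (pos i)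
point (neg fz)     = newNeg
point (neg (fs i)) = old (neg i)

point-shift : ∀ {n} (a : Elem n) → point (shift a) ≡ old a
point-shift zer     = refl
point-shift (pos i) = refl
point-shift (neg i) = refl

negP : ∀ {n} → Point n → Point n
negP (old a) = old (negE a)
negP newPos  = newNeg
negP newNeg  = newPos

point-negE : ∀ {n} (x : Elem (suc n)) → point (negE x) ≡ negP (point x)
point-negE zer          = refl
point-negE (pos fz)     = refl
point-negE (pos (fs i)) = refl
point-negE (neg fz)     = refl
point-negE (neg (fs i)) = refl

sameBlock : ∀ {n} → Relᵇ n → Point n → Point n → Bool
sameBlock h (old a) (old b) = h (a , b)
sameBlock h newPos  newPos  = true
sameBlock h newNeg  newNeg  = true
sameBlock h _       _       = false

newPair : ∀ {n} → Relᵇ n → Relᵇ (suc n)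
newPair h (x , y) = sameBlock h (point x) (point y)

newPair-restrict : ∀ {n} (h : Relᵇ n) → newPair h ∘ shift² ≗ h
newPair-restrict h (b , c) rewrite point-shift b | point-shift c = refl

newPair-alone : ∀ {n} (h : Relᵇ n) b → newPair h (new⁺ , shift b) ≡ false
newPair-alone h b = cong (sameBlock h newPos) (point-shift b)

module _ {n : ℕ} {h : Relᵇ n} (t : IsTypeB h) where
  open IsTypeB t

  private
    same-refl : ∀ p → sameBlock h p p ≡ true
    same-refl (old a) = reflexive a
    same-refl newPos  = refl
    same-refl newNeg  = refl

    same-sym : ∀ p q → sameBlock h p q ≡ true → sameBlock h q p ≡ true
    same-sym (old a) (old b) = symmetric a b
    same-sym newPos  newPos  = λ _ → refl
    same-sym newNeg  newNeg  = λ _ → refl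
    same-sym (old _) newPos  ()
    same-sym (old _) newNeg  ()
    same-sym newPos  (old _) ()
    same-sym newPos  newNeg  ()
    same-sym newNeg  (old _) ()
    same-sym newNeg  newPos  ()

    same-trans : ∀ p q r → sameBlock h p q ≡ true → sameBlock h q r ≡ true → sameBlock h p r ≡ true
    same-trans (old a) (old b) (old c) = transitive a b c
    same-trans newPos  newPos  newPos  = λ _ _ → refl
    same-trans newNeg  newNeg  newNeg  = λ _ _ → refl
    same-trans (old _) (old _) newPos  _  ()
    same-trans (old _) (old _) newNeg  _  ()
    same-trans (old _) newPos  _       () _
    same-trans (old _) newNeg  _       () _
    same-trans newPos  (old _) _       () _
    same-trans newPos  newNeg  _       () _
    same-trans newPos  newPos  (old _) _  ()
    same-trans newPos  newPos  newNeg  _  ()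
    same-trans newNeg  (old _) _       () _
    same-trans newNeg  newPos  _       () _
    same-trans newNeg  newNeg  (old _) _  ()
    same-trans newNeg  newNeg  newPos  _  ()

    same-neg : ∀ p q → sameBlock h p q ≡ true → sameBlock h (negP p) (negP q) ≡ true
    same-neg (old a) (old b) = negation a b
    same-neg newPos  newPos  = λ _ → refl
    same-neg newNeg  newNeg  = λ _ → refl
    same-neg (old _) newPos  ()
    same-neg (old _) newNeg  ()
    same-neg newPos  (old _) ()
    same-neg newPos  newNeg  ()
    same-neg newNeg  (old _) ()
    same-neg newNeg  newPos  ()

    same-selfNeg : ∀ p → sameBlock h p (negP p) ≡ true → sameBlock h p (old zer) ≡ true
    same-selfNeg (old a) = selfNegative a
    same-selfNeg newPos  ()
    same-selfNeg newNeg  ()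

  IsTypeB-newPair : IsTypeB (newPair h)
  IsTypeB-newPair = record
    { reflexive    = same-refl ∘ point
    ; symmetric    = λ x y → same-sym (point x) (point y)
    ; transitive   = λ x y z → same-trans (point x) (point y) (point z)
    ; negation     = λ x y → subst (λ (p , q) → sameBlock h p q ≡ true)
                                   (sym (cong₂ _,_ (point-negE x) (point-negE y)))
                             ∘ same-neg (point x) (point y)
    ; selfNegative = λ x → same-selfNeg (point x) ∘ subst (λ q → sameBlock h (point x) q ≡ true) (point-negE x)
    }

module _ {m : ℕ} {f : Relᵇ m} (t : IsTypeB f) where
  open IsTypeB t

  related-cong : ∀ {x x′ z z′} → f (x , x′) ≡ true → f (z , z′) ≡ true → f (x , z) ≡ f (x′ , z′)
  related-cong {x} {x′} {z} {z′} xx′ zz′ = Bool.⇔→≡ (mk⇔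
    (λ xz → transitive x′ x z′ (symmetric x x′ xx′) (transitive x z z′ xz zz′))
    (λ x′z′ → transitive x x′ z xx′ (transitive x′ z′ z x′z′ (symmetric z z′ zz′))))

module _ {n : ℕ} {h : Relᵇ n} {f : Relᵇ (suc n)} (tf : IsTypeB f) (f≗h : f ∘ shift² ≗ h) where
  open IsTypeB tf

  joined⇒joinClass : ∀ {a} → f (new⁺ , shift a) ≡ true → f ≗ joinClass h a
  joined⇒joinClass {a} f1a (x , z) =
    trans (related-cong tf (anchor x) (anchor z)) (f≗h (collapse a x , collapse a z))
    where
    anchor : ∀ x → f (x , shift (collapse a x)) ≡ true
    anchor zer          = reflexive zer
    anchor (pos fz)     = f1a
    anchor (pos (fs i)) = reflexive (pos (fs i))
    anchor (neg fz)     = transport-rel f refl (negE-shift a) (negation new⁺ (shift a) f1a)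
    anchor (neg (fs i)) = reflexive (neg (fs i))

  private
    new⁻-to-new⁺ : ∀ {c} → f (new⁻ , shift c) ≡ true → f (new⁺ , shift (negE c)) ≡ true
    new⁻-to-new⁺ {c} = transport-rel f refl (negE-shift c) ∘ negation new⁻ (shift c)

  alone⇒newPair : (∀ c → f (new⁺ , shift c) ≡ false) → f ≗ newPair h
  alone⇒newPair alone (x , z) with view x | view z
  ... | fresh⁺    | fresh⁺    = reflexive new⁺
  ... | fresh⁻    | fresh⁻    = reflexive new⁻
  ... | fresh⁺    | fresh⁻    = Bool.¬-not λ f1-1 → ≡true⇒≢false (selfNegative new⁺ f1-1) (alone zer)
  ... | fresh⁻    | fresh⁺    =
    Bool.¬-not λ f-11 → ≡true⇒≢false (selfNegative new⁺ (symmetric new⁻ new⁺ f-11)) (alone zer)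
  ... | fresh⁺    | shifted c = trans (alone c) (cong (sameBlock h newPos) (sym (point-shift c)))
  ... | shifted c | fresh⁺    = trans (Bool.¬-not λ fc1 → ≡true⇒≢false (symmetric _ _ fc1) (alone c))
                                      (cong (λ p → sameBlock h p newPos) (sym (point-shift c)))
  ... | fresh⁻    | shifted c = trans (Bool.¬-not λ f-1c → ≡true⇒≢false (new⁻-to-new⁺ f-1c) (alone (negE c)))
                                      (cong (sameBlock h newNeg) (sym (point-shift c)))
  ... | shifted c | fresh⁻    =
    trans (Bool.¬-not λ fc-1 → ≡true⇒≢false (new⁻-to-new⁺ (symmetric _ _ fc-1)) (alone (negE c)))
          (cong (λ p → sameBlock h p newNeg) (sym (point-shift c)))
  ... | shifted b | shifted c = trans (f≗h (b , c)) (sym (newPair-restrict h (b , c)))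

  private
    th : IsTypeB h
    th = IsTypeB-≗ f≗h (IsTypeB-restrict tf)

  extension-cases : (Σ (Elem n) λ a → isClassMin h a ≡ true × f ≗ joinClass h a) ⊎ (f ≗ newPair h)
  extension-cases with any (λ y → f (new⁺ , shift y)) (elems n) in related
  ... | true  = let y , _ , f1y     = any-true-witness _ (elems n) related
                    a , a-min , hay = classMin-exists th y
                in inj₁ (a , a-min , joined⇒joinClass
                              (transitive _ _ _ f1y (trans (f≗h (y , a)) (IsTypeB.symmetric th a y hay))))
  ... | false = inj₂ (alone⇒newPair (λ c → any-false-elim _ related (∈-elems c)))

module _ {n : ℕ} {h : Relᵇ n} (t : IsTypeB h) where
  open IsTypeB t

  classCount-joinClass : ∀ a → classCount (joinClass h a) ≡ classCount h
  classCount-joinClass a = begin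
    classCount f                                     ≡⟨ classCount-newFirst (IsTypeB-joinClass t a) ⟩
    classesIn f (new⁺ ∷ new⁻ ∷ shiftedPoints n)     ≡⟨ dropNew ⟩
    classesIn f (shiftedPoints n)
      ≡⟨ classesIn-shifted (IsTypeB-joinClass t a) (joinClass-restrict h a) ⟩
    classesIn h (elems n)                            ≡⟨ classCount≡classesIn t ⟨
    classCount h                                     ∎
    where
    open ≡-Reasoning
    f : Relᵇ (suc n)
    f = joinClass h a
    dropNew : classesIn f (new⁺ ∷ new⁻ ∷ shiftedPoints n) ≡ classesIn f (shiftedPoints n)
    dropNew rewrite any-intro (λ y → f (new⁺ , y)) (new⁻ ∷ shiftedPoints n) (there (∈-map⁺ shift (∈-elems a)))
                      (trans (joinClass-joined h a a) (reflexive a))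
                  | any-intro (λ y → f (new⁻ , y)) (shiftedPoints n) (∈-map⁺ shift (∈-elems (negE a)))
                      (trans (cong (λ y → h (negE a , y)) (collapse-shift a (negE a))) (reflexive (negE a)))
                  = refl

  classCount-newPair : classCount (newPair h) ≡ suc (suc (classCount h))
  classCount-newPair = begin
    classCount f                                     ≡⟨ classCount-newFirst (IsTypeB-newPair t) ⟩
    classesIn f (new⁺ ∷ new⁻ ∷ shiftedPoints n)     ≡⟨ keepNew ⟩
    suc (suc (classesIn f (shiftedPoints n)))
      ≡⟨ cong (suc ∘ suc) (classesIn-shifted (IsTypeB-newPair t) (newPair-restrict h)) ⟩
    suc (suc (classesIn h (elems n)))                ≡⟨ cong (suc ∘ suc) (classCount≡classesIn t) ⟨
    suc (suc (classCount h))                         ∎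
    where
    open ≡-Reasoning
    f : Relᵇ (suc n)
    f = newPair h
    keepNew : classesIn f (new⁺ ∷ new⁻ ∷ shiftedPoints n) ≡ suc (suc (classesIn f (shiftedPoints n)))
    keepNew rewrite trans (any-map (λ y → f (new⁺ , y)) shift (elems n))
                          (any-false-intro _ (elems n) λ {b} _ → newPair-alone h b)
                  | trans (any-map (λ y → f (new⁻ , y)) shift (elems n))
                          (any-false-intro _ (elems n) λ {b} _ → cong (sameBlock h newNeg) (point-shift b))
                  = refl

-- Separated partitions without zero block

module _ {m : ℕ} {h : Relᵇ (suc m)} (s : IsSeparated h) where
  open IsSeparated s
  open IsTypeB typeB

  joinClass-separated : ∀ a → h (a , zer) ≡ false → h (a , pos fz) ≡ false → IsSeparated (joinClass h a)
  joinClass-separated a a≁0 a≁1 = record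
    { typeB        = IsTypeB-joinClass typeB a
    ; zeroAlone    = zeroAlone′
    ; noSuccession = noSuccession′
    }
    where
    zeroAlone′ : ∀ x → joinClass h a (x , zer) ≡ true → x ≡ zer
    zeroAlone′ zer          _   = refl
    zeroAlone′ (pos fz)     a∼0 = ⊥-elim (≡true⇒≢false a∼0 a≁0)
    zeroAlone′ (pos (fs i)) i∼0 with () ← zeroAlone (pos i) i∼0
    zeroAlone′ (neg fz)     -a∼0 =
      ⊥-elim (≡true⇒≢false (transport-rel h (negE-involutive a) refl (negation (negE a) zer -a∼0)) a≁0)
    zeroAlone′ (neg (fs i)) i∼0 with () ← zeroAlone (neg i) i∼0
    noSuccession′ : ∀ i j → (toℕ j ≡ᵇ suc (toℕ i)) ≡ true → joinClass h a (pos i , pos j) ≡ false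
    noSuccession′ fz     (fs fz)     _     = a≁1
    noSuccession′ (fs i) (fs j)      j≡i+1 = noSuccession i j j≡i+1
    noSuccession′ fz     fz          ()
    noSuccession′ fz     (fs (fs _)) ()
    noSuccession′ (fs i) fz          ()

joinClass-separated⁻¹ : ∀ {m} {h : Relᵇ (suc m)} a → IsSeparated (joinClass h a) →
  h (a , zer) ≡ false × h (a , pos fz) ≡ false
joinClass-separated⁻¹ a s =
  Bool.¬-not (λ a∼0 → case zeroAlone new⁺ a∼0 of λ ()) , noSuccession fz (fs fz) refl
  where open IsSeparated s

newPair-separated : ∀ {n} {h : Relᵇ n} → IsSeparated h → IsSeparated (newPair h)
newPair-separated {h = h} s = record
  { typeB        = IsTypeB-newPair typeB
  ; zeroAlone    = zeroAlone′
  ; noSuccession = noSuccession′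
  }
  where
  open IsSeparated s
  zeroAlone′ : ∀ x → newPair h (x , zer) ≡ true → x ≡ zer
  zeroAlone′ zer          _   = refl
  zeroAlone′ (pos (fs i)) i∼0 with () ← zeroAlone (pos i) i∼0
  zeroAlone′ (neg (fs i)) i∼0 with () ← zeroAlone (neg i) i∼0
  noSuccession′ : ∀ i j → (toℕ j ≡ᵇ suc (toℕ i)) ≡ true → newPair h (pos i , pos j) ≡ false
  noSuccession′ fz     (fs j) _     = refl
  noSuccession′ (fs i) (fs j) j≡i+1 = noSuccession i j j≡i+1
  noSuccession′ fz     fz     ()
  noSuccession′ (fs i) fz     ()

-- a is the least element of a class that a new 1 inserted in front may join: the class contains
-- neither 0 nor the old 1, which becomes 2.
joinable : ∀ {m} → Relᵇ (suc m) → Elem (suc m) → Bool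
joinable h a = isClassMin h a ∧ not (h (a , zer)) ∧ not (h (a , pos fz))

module _ {m : ℕ} {h : Relᵇ (suc m)} (s : IsSeparated h) where
  open IsSeparated s
  open IsTypeB typeB

  private
    E : List (Elem (suc m))
    E = elems (suc m)
    minimal withZero withOne : Elem (suc m) → Bool
    minimal    = isClassMin h
    withZero a = h (a , zer)
    withOne  a = h (a , pos fz)

    zeroClass : countB (λ a → minimal a ∧ withZero a) E ≡ 1
    zeroClass = countB-single E (elems-unique (suc m)) (∈-elems zer) (∧-true (zer-isClassMin h) (reflexive zer))
      λ {a} e → classMin-unique typeB (∧-trueˡ e) (zer-isClassMin h) (∧-trueʳ {minimal a} e)

    oneClass : countB (λ a → (minimal a ∧ not (withZero a)) ∧ withOne a) E ≡ 1
    oneClass with classMin-exists typeB (pos fz)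
    ... | c , c-min , c∼1 = countB-single E (elems-unique (suc m)) (∈-elems c)
          (∧-true (∧-true c-min (cong not (Bool.¬-not c≁0))) c∼1)
          λ {a} e → classMin-unique typeB (∧-trueˡ (∧-trueˡ e)) c-min
                      (transitive a (pos fz) c (∧-trueʳ {minimal a ∧ not (withZero a)} e) (symmetric c (pos fz) c∼1))
      where
      c≁0 : h (c , zer) ≢ true
      c≁0 c∼0 with () ← zeroAlone (pos fz) (transitive (pos fz) c zer (symmetric c (pos fz) c∼1) c∼0)

  classCount≡joinable+2 : classCount h ≡ suc (suc (countB (joinable h) E))
  classCount≡joinable+2 = begin
    countB minimal E
      ≡⟨ countB-split minimal withZero E ⟩
    countB (λ a → minimal a ∧ withZero a) E + countB (λ a → minimal a ∧ not (withZero a)) E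
      ≡⟨ cong₂ _+_ zeroClass (countB-split (λ a → minimal a ∧ not (withZero a)) withOne E) ⟩
    1 + (countB (λ a → (minimal a ∧ not (withZero a)) ∧ withOne a) E
         + countB (λ a → (minimal a ∧ not (withZero a)) ∧ not (withOne a)) E)
      ≡⟨ cong (λ k → suc (k + countB (λ a → (minimal a ∧ not (withZero a)) ∧ not (withOne a)) E)) oneClass ⟩
    suc (suc (countB (λ a → (minimal a ∧ not (withZero a)) ∧ not (withOne a)) E))
      ≡⟨ cong (suc ∘ suc) (countB-cong E λ {a} _ → Bool.∧-assoc (minimal a) _ _) ⟩
    suc (suc (countB (joinable h) E)) ∎
    where open ≡-Reasoning

-- Weighted counts

weighted : ∀ {n} → (Relᵇ n → Bool) → (ℕ → ℕ) → Relᵇ n → ℕ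
weighted P φ f = if P f then φ (classCount f) else 0

agree⇒≗ : ∀ {n} {f s : Relᵇ (suc n)} {h : Relᵇ n} → f ∘ shift² ≗ h → s ∘ shift² ≗ h →
  PairSums.agree (newPairs n) s f ≡ true → f ≗ s
agree⇒≗ {n} {f} {s} f≗h s≗h agreeing xy with ∈-++⁻ (newPairs n) (∈-pairs {suc n} xy)
... | inj₁ xy∈new = PairSums.agree⇒≡ {xs = newPairs n} {s} {f} agreeing xy∈new
... | inj₂ xy∈old with ∈-map⁻ shift² xy∈old
...   | ab , _ , refl = trans (f≗h ab) (sym (s≗h ab))

module _ {n : ℕ} {h : Relᵇ n} (t : IsTypeB h) where

  joinClass-injective : ∀ {a b} → isClassMin h a ≡ true → isClassMin h b ≡ true →
    joinClass h a ≗ joinClass h b → a ≡ b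
  joinClass-injective {a} {b} a-min b-min ja≗jb = classMin-unique t a-min b-min
    (trans (sym (joinClass-joined h a b))
           (trans (ja≗jb (new⁺ , shift b)) (trans (joinClass-joined h b b) (IsTypeB.reflexive t b))))

  joinClass≉newPair : ∀ a → ¬ (joinClass h a ≗ newPair h)
  joinClass≉newPair a ja≗new = ≡true⇒≢false
    (trans (joinClass-joined h a a) (IsTypeB.reflexive t a))
    (trans (ja≗new (new⁺ , shift a)) (newPair-alone h a))

update-restrict : ∀ {n} {x} b (f : Relᵇ (suc n)) → x ∈ newPairs n →
  PairSums.update x b f ∘ shift² ≗ f ∘ shift²
update-restrict b f x∈ ab = PairSums.update-other b f λ ab≡x →
  ≡true⇒≢false (newPairs-involveNew x∈) (trans (cong involvesNew (sym ab≡x)) (involvesNew-shift² ab))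

sumOver-newPairs-cong : ∀ {n} {F G : Relᵇ (suc n) → ℕ} {h : Relᵇ n} {g} → g ∘ shift² ≗ h →
  (∀ f → f ∘ shift² ≗ h → F f ≡ G f) → PairSums.sumOver (newPairs n) F g ≡ PairSums.sumOver (newPairs n) G g
sumOver-newPairs-cong {n} {h = h} g≗h F≡G = PairSums.sumOver-cong-on (λ f → f ∘ shift² ≗ h) (newPairs n)
  (λ b f x∈ f≗h ab → trans (update-restrict b f x∈ ab) (f≗h ab)) g≗h F≡G

module ExtensionSum {n : ℕ} {h : Relᵇ n} (th : IsTypeB h)
  (P : Relᵇ (suc n) → Bool) (P-cong : ∀ {f f′} → f ≗ f′ → P f ≡ P f′)
  (candidate : Elem n → Bool) (candidate-min : ∀ {a} → candidate a ≡ true → isClassMin h a ≡ true)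
  (cases : ∀ {f} → P f ≡ true → f ∘ shift² ≗ h →
           (Σ (Elem n) λ a → candidate a ≡ true × f ≗ joinClass h a) ⊎ (f ≗ newPair h))
  (P-joinClass : ∀ {a} → candidate a ≡ true → P (joinClass h a) ≡ true)
  (P-newPair : P (newPair h) ≡ true)
  (ψ : ℕ → ℕ) where

  open PairSums {suc n}

  private
    NP : List (Elem (suc n) × Elem (suc n))
    NP = newPairs n
    w₁ w₂ : ℕ
    w₁ = ψ (classCount h)
    w₂ = ψ (suc (suc (classCount h)))

    joinTerm : Elem n → Relᵇ (suc n) → ℕ
    joinTerm a f = if candidate a ∧ agree NP (joinClass h a) f then w₁ else 0

    newTerm : Relᵇ (suc n) → ℕ
    newTerm f = if agree NP (newPair h) f then w₂ else 0

    decomposition : Relᵇ (suc n) → ℕ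
    decomposition f = sumMap (λ a → joinTerm a f) (elems n) + newTerm f

    module _ {f : Relᵇ (suc n)} (f≗h : f ∘ shift² ≗ h) where

      joinTerm-vanishes : ∀ {a} → (candidate a ≡ true → f ≗ joinClass h a → ⊥) → joinTerm a f ≡ 0
      joinTerm-vanishes {a} ¬join with candidate a | agree NP (joinClass h a) f in agreeing
      ... | true  | true  = ⊥-elim (¬join refl (agree⇒≗ f≗h (joinClass-restrict h a) agreeing))
      ... | true  | false = refl
      ... | false | _     = refl

      newTerm-vanishes : (f ≗ newPair h → ⊥) → newTerm f ≡ 0
      newTerm-vanishes ¬new with agree NP (newPair h) f in agreeing
      ... | true  = ⊥-elim (¬new (agree⇒≗ f≗h (newPair-restrict h) agreeing))
      ... | false = refl

      decomposition-zero : P f ≡ false → decomposition f ≡ 0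
      decomposition-zero ¬Pf = cong₂ _+_
        (sumMap-zero (elems n) λ _ → joinTerm-vanishes λ ca f≗j → ≢P (P-cong f≗j) (P-joinClass ca))
        (newTerm-vanishes λ f≗new → ≢P (P-cong f≗new) P-newPair)
        where
        ≢P : ∀ {f′} → P f ≡ P f′ → P f′ ≡ true → ⊥
        ≢P Pf≡Pf′ Pf′ = ≡true⇒≢false (trans Pf≡Pf′ Pf′) ¬Pf

      decomposition-joinClass : ∀ {a₀} → candidate a₀ ≡ true → f ≗ joinClass h a₀ → decomposition f ≡ w₁
      decomposition-joinClass {a₀} ca₀ f≗j =
        trans (cong₂ _+_ (sumMap-supportedAt (elems n) (elems-unique n) (∈-elems a₀) others) noNew)
              (trans (+-identityʳ _) hit)
        where
        hit : joinTerm a₀ f ≡ w₁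
        hit rewrite ca₀ | ≗⇒agree NP f≗j = refl
        others : ∀ {a} → a ∈ elems n → a ≢ a₀ → joinTerm a f ≡ 0
        others _ a≢a₀ = joinTerm-vanishes λ ca f≗ja →
          a≢a₀ (joinClass-injective th (candidate-min ca) (candidate-min ca₀) (λ xy → trans (sym (f≗ja xy)) (f≗j xy)))
        noNew : newTerm f ≡ 0
        noNew = newTerm-vanishes λ f≗new → joinClass≉newPair th a₀ (λ xy → trans (sym (f≗j xy)) (f≗new xy))

      decomposition-newPair : f ≗ newPair h → decomposition f ≡ w₂
      decomposition-newPair f≗new = cong₂ _+_ noJoin hit
        where
        noJoin : sumMap (λ a → joinTerm a f) (elems n) ≡ 0
        noJoin = sumMap-zero (elems n) λ {a} _ → joinTerm-vanishes λ _ f≗ja →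
          joinClass≉newPair th a (λ xy → trans (sym (f≗ja xy)) (f≗new xy))
        hit : newTerm f ≡ w₂
        hit rewrite ≗⇒agree NP f≗new = refl

      -- exactly one term of the decomposition survives, matching the case of f
      weighted≡decomposition : weighted P ψ f ≡ decomposition f
      weighted≡decomposition with P f in Pf
      ... | false = sym (decomposition-zero Pf)
      ... | true with cases Pf f≗h
      ...   | inj₁ (a₀ , ca₀ , f≗j) = trans (cong ψ (trans (classCount-cong f≗j) (classCount-joinClass th a₀)))
                                            (sym (decomposition-joinClass ca₀ f≗j))
      ...   | inj₂ f≗new = trans (cong ψ (trans (classCount-cong f≗new) (classCount-newPair th)))
                                 (sym (decomposition-newPair f≗new))

  sumOver-joinTerm : ∀ a g → sumOver NP (joinTerm a) g ≡ (if candidate a then w₁ else 0)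
  sumOver-joinTerm a g with candidate a
  ... | true  = sumOver-agree NP (newPairs-unique n) (joinClass h a) w₁ g
  ... | false = sumOver-zero NP g

  sumOver-decomposition : ∀ g → sumOver NP decomposition g ≡ countB candidate (elems n) * w₁ + w₂
  sumOver-decomposition g = begin
    sumOver NP decomposition g
      ≡⟨ sumOver-+ NP (λ f → sumMap (λ a → joinTerm a f) (elems n)) newTerm g ⟩
    sumOver NP (λ f → sumMap (λ a → joinTerm a f) (elems n)) g + sumOver NP newTerm g
      ≡⟨ cong₂ _+_ (sumOver-sumMap NP joinTerm (elems n) g)
                   (sumOver-agree NP (newPairs-unique n) (newPair h) w₂ g) ⟩
    sumMap (λ a → sumOver NP (joinTerm a) g) (elems n) + w₂
      ≡⟨ cong (_+ w₂) (sumMap-cong (elems n) λ {a} _ → sumOver-joinTerm a g) ⟩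
    sumMap (λ a → if candidate a then w₁ else 0) (elems n) + w₂
      ≡⟨ cong (_+ w₂) (sumMap-if candidate w₁ (elems n)) ⟩
    countB candidate (elems n) * w₁ + w₂ ∎
    where open ≡-Reasoning

  extensionSum : ∀ g → g ∘ shift² ≗ h →
    sumOver (newPairs n) (weighted P ψ) g
      ≡ countB candidate (elems n) * ψ (classCount h) + ψ (suc (suc (classCount h)))
  extensionSum g g≗h =
    trans (sumOver-newPairs-cong g≗h (λ f → weighted≡decomposition {f})) (sumOver-decomposition g)

weighted-extensional : ∀ {n} {P : Relᵇ n → Bool} → (∀ {f f′} → f ≗ f′ → P f ≡ P f′) →
  ∀ φ → PairSums.Extensional (weighted P φ)
weighted-extensional P-cong φ f≗f′ = cong₂ (λ b c → if b then φ c else 0) (P-cong f≗f′) (classCount-cong f≗f′)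

sumOver-pairs-suc : ∀ n {F : Relᵇ (suc n) → ℕ} {G : Relᵇ n → ℕ} → PairSums.Extensional F →
  (∀ h g → g ∘ shift² ≗ h → PairSums.sumOver (newPairs n) F g ≡ G h) →
  PairSums.sumOver (pairs (suc n)) F (const false) ≡ PairSums.sumOver (pairs n) G (const false)
sumOver-pairs-suc n {F} {G} ext extensions = begin
  sumOver (pairs (suc n)) F (const false)
    ≡⟨ sumOver-++ (newPairs n) (map shift² (pairs n)) F (const false) ⟩
  sumOver (map shift² (pairs n)) (sumOver (newPairs n) F) (const false)
    ≡⟨ ShiftPullback.sumOver-map (pairs n) (sumOver-extensional (newPairs n) ext) (const false) ⟩
  sumOver (pairs n) (λ h → sumOver (newPairs n) F (ShiftPullback.glue h (const false))) (const false)
    ≡⟨ sumOver-cong (pairs n) (λ h → extensions h _ (ShiftPullback.glue-e h (const false))) ⟩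
  sumOver (pairs n) G (const false) ∎
  where
  open ≡-Reasoning
  open PairSums

sumOver-newPairs-zero : ∀ {n} {P : Relᵇ (suc n) → Bool} {h : Relᵇ n} φ g → g ∘ shift² ≗ h →
  (∀ {f} → f ∘ shift² ≗ h → P f ≢ true) → PairSums.sumOver (newPairs n) (weighted P φ) g ≡ 0
sumOver-newPairs-zero {n} {P} φ g g≗h ¬P =
  trans (sumOver-newPairs-cong g≗h vanishes) (PairSums.sumOver-zero (newPairs n) g)
  where
  vanishes : ∀ f → f ∘ shift² ≗ _ → weighted P φ f ≡ 0
  vanishes f f≗h with P f in Pf
  ... | true  = ⊥-elim (¬P f≗h Pf)
  ... | false = refl

typeBSum : ℕ → (ℕ → ℕ) → ℕ
typeBSum n φ = PairSums.sumOver (pairs n) (weighted typeBᵇ φ) (const false)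

separatedSum : ℕ → (ℕ → ℕ) → ℕ
separatedSum n ψ = PairSums.sumOver (pairs n) (weighted separatedᵇ ψ) (const false)

typeB-extensions : ∀ {n} φ (h : Relᵇ n) g → g ∘ shift² ≗ h →
  PairSums.sumOver (newPairs n) (weighted typeBᵇ φ) g ≡ weighted typeBᵇ (λ c → c * φ c + φ (suc (suc c))) h
typeB-extensions φ h g g≗h with typeBᵇ h in Th
... | true  = ExtensionSum.extensionSum t typeBᵇ typeBᵇ-cong (isClassMin h) id
                (λ {f} Tf f≗h → extension-cases (typeBᵇ-sound {f = f} Tf) f≗h)
                (λ {a} _ → typeBᵇ-complete (IsTypeB-joinClass t a)) (typeBᵇ-complete (IsTypeB-newPair t)) φ g g≗h
  where
  t : IsTypeB h
  t = typeBᵇ-sound {f = h} Th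
... | false = sumOver-newPairs-zero φ g g≗h λ {f} f≗h Tf → ≡true⇒≢false (typeBᵇ-restrict {f = f} f≗h Tf) Th

typeBSum-suc : ∀ n φ → typeBSum (suc n) φ ≡ typeBSum n (λ c → c * φ c + φ (suc (suc c)))
typeBSum-suc n φ = sumOver-pairs-suc n (weighted-extensional typeBᵇ-cong φ) (typeB-extensions φ)

separated-extensions : ∀ {m} ψ (h : Relᵇ (suc m)) g → g ∘ shift² ≗ h →
  PairSums.sumOver (newPairs (suc m)) (weighted separatedᵇ ψ) g ≡
  weighted separatedᵇ (λ c → (c ∸ 2) * ψ c + ψ (suc (suc c))) h
separated-extensions {m} ψ h g g≗h with separatedᵇ h in Sh
... | true  = trans
  (ExtensionSum.extensionSum (IsSeparated.typeB s) separatedᵇ separatedᵇ-cong (joinable h) ∧-trueˡ cases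
     (λ {a} ja → separatedᵇ-complete (joinClass-separated s a
                   (Bool.not-injective (∧-trueˡ (∧-trueʳ {isClassMin h a} ja)))
                   (Bool.not-injective (∧-trueʳ (∧-trueʳ {isClassMin h a} ja)))))
     (separatedᵇ-complete (newPair-separated s)) ψ g g≗h)
  (cong (λ k → k * ψ (classCount h) + ψ (suc (suc (classCount h))))
        (sym (cong (_∸ 2) (classCount≡joinable+2 s))))
  where
  s : IsSeparated h
  s = separatedᵇ-sound {f = h} Sh
  cases : ∀ {f} → separatedᵇ f ≡ true → f ∘ shift² ≗ h →
    (Σ (Elem (suc m)) λ a → joinable h a ≡ true × f ≗ joinClass h a) ⊎ (f ≗ newPair h)
  cases {f} Sf f≗h with extension-cases (IsSeparated.typeB (separatedᵇ-sound {f = f} Sf)) f≗h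
  ... | inj₂ f≗new = inj₂ f≗new
  ... | inj₁ (a , a-min , f≗j) =
    let a≁0 , a≁1 = joinClass-separated⁻¹ {h = h} a (IsSeparated-≗ f≗j (separatedᵇ-sound {f = f} Sf))
    in inj₁ (a , ∧-true a-min (∧-true (cong not a≁0) (cong not a≁1)) , f≗j)
... | false = sumOver-newPairs-zero ψ g g≗h λ {f} f≗h Sf → ≡true⇒≢false (separatedᵇ-restrict {f = f} f≗h Sf) Sh

separatedSum-suc : ∀ m ψ →
  separatedSum (suc (suc m)) ψ ≡ separatedSum (suc m) (λ c → (c ∸ 2) * ψ c + ψ (suc (suc c)))
separatedSum-suc m ψ = sumOver-pairs-suc (suc m) (weighted-extensional separatedᵇ-cong ψ) (separated-extensions ψ)

typeBSum-zero : ∀ φ → typeBSum 0 φ ≡ φ 1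
typeBSum-zero φ = +-identityʳ (φ 1)

-- by evaluation: {0}, {1}, {−1} is the only separated partition of ⟨1⟩ without zero block
separatedSum-one : ∀ ψ → separatedSum 1 ψ ≡ ψ 3
separatedSum-one ψ = trans (+-identityʳ _) (trans (+-identityʳ _) (+-identityʳ _))

separatedSum-cong : ∀ m {ψ₁ ψ₂ : ℕ → ℕ} →
  (∀ {h : Relᵇ m} → separatedᵇ h ≡ true → ψ₁ (classCount h) ≡ ψ₂ (classCount h)) →
  separatedSum m ψ₁ ≡ separatedSum m ψ₂
separatedSum-cong m {ψ₁} {ψ₂} ψ₁≡ψ₂ = PairSums.sumOver-cong (pairs m) pointwise
  where
  pointwise : ∀ f → weighted separatedᵇ ψ₁ f ≡ weighted separatedᵇ ψ₂ f
  pointwise f with separatedᵇ f in Sf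
  ... | true  = ψ₁≡ψ₂ Sf
  ... | false = refl

typeBSum≡separatedSum : ∀ n φ → typeBSum n φ ≡ separatedSum (suc n) (φ ∘ (_∸ 2))
typeBSum≡separatedSum zero    φ = trans (typeBSum-zero φ) (sym (separatedSum-one (φ ∘ (_∸ 2))))
typeBSum≡separatedSum (suc n) φ = begin
  typeBSum (suc n) φ
    ≡⟨ typeBSum-suc n φ ⟩
  typeBSum n step
    ≡⟨ typeBSum≡separatedSum n step ⟩
  separatedSum (suc n) (step ∘ (_∸ 2))
    ≡⟨ separatedSum-cong (suc n) {step ∘ (_∸ 2)} {separatedStep} (λ {h} → step≡ {h}) ⟩
  separatedSum (suc n) separatedStep
    ≡⟨ separatedSum-suc n (φ ∘ (_∸ 2)) ⟨
  separatedSum (suc (suc n)) (φ ∘ (_∸ 2)) ∎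
  where
  open ≡-Reasoning
  step separatedStep : ℕ → ℕ
  step c          = c * φ c + φ (suc (suc c))
  separatedStep c = (c ∸ 2) * φ (c ∸ 2) + φ (suc (suc c) ∸ 2)
  step≡ : ∀ {h : Relᵇ (suc n)} → separatedᵇ h ≡ true → step (classCount h ∸ 2) ≡ separatedStep (classCount h)
  step≡ {h} Sh with classCount h | classCount≡joinable+2 {m = n} {h = h} (separatedᵇ-sound {f = h} Sh)
  ... | _ | refl = refl

classCount-positive : ∀ {n} (f : Relᵇ n) → Σ ℕ λ k → classCount f ≡ suc k
classCount-positive {n} f = _ , cong (λ b → if b then suc rest else rest) (zer-isClassMin f)
  where
  rest : ℕ
  rest = countB (isClassMin f) (map pos (allFin n) ++ map neg (allFin n))

-- A type B partition with c classes has (c + 1) / 2 blocks, one without zero block (c − 1) / 2 pairs.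
hasBlocks hasPairs : ℕ → ℕ → ℕ
hasBlocks k c = if ⌊ suc c /2⌋ ≡ᵇ k then 1 else 0
hasPairs  k c = if ⌊ c ∸ 1 /2⌋ ≡ᵇ k then 1 else 0

hasBlocks≡hasPairs : ∀ k c → hasBlocks k (c ∸ 2) ≡ hasPairs k c
hasBlocks≡hasPairs k zero          = refl
hasBlocks≡hasPairs k (suc zero)    = refl
hasBlocks≡hasPairs k (suc (suc c)) = refl

numTypeB≡typeBSum : ∀ n k → numTypeB n k ≡ typeBSum n (hasBlocks k)
numTypeB≡typeBSum n k = begin
  numTypeB n k
    ≡⟨ countB-as-sum _ (allRels n) ⟩
  sumMap (λ R → if isTypeB R ∧ (blocksB R ≡ᵇ k) then 1 else 0) (allRels n)
    ≡⟨ sumMap-cong (allRels n) (λ {R} _ → weight (uncurry (rel R))) ⟩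
  sumMap (weighted typeBᵇ (hasBlocks k) ∘ uncurry ∘ rel) (allRels n)
    ≡⟨ relations-sum n _ (weighted-extensional typeBᵇ-cong (hasBlocks k)) ⟩
  typeBSum n (hasBlocks k) ∎
  where
  open ≡-Reasoning
  weight : ∀ f → (if typeBᵇ f ∧ (suc ⌊ classCount f ∸ 1 /2⌋ ≡ᵇ k) then 1 else 0)
                 ≡ weighted typeBᵇ (hasBlocks k) f
  weight f with classCount-positive f
  ... | _ , count≡ rewrite count≡ = Bool.if-∧ (typeBᵇ f)

numSepNoZero≡separatedSum : ∀ n k → numSepNoZero n k ≡ separatedSum n (hasPairs k)
numSepNoZero≡separatedSum n k = begin
  numSepNoZero n k
    ≡⟨ countB-as-sum _ (allRels n) ⟩
  sumMap (λ R → if isSeparatedNoZero R ∧ (numPairs R ≡ᵇ k) then 1 else 0) (allRels n)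
    ≡⟨ sumMap-cong (allRels n) (λ {R} _ → weight R) ⟩
  sumMap (weighted separatedᵇ (hasPairs k) ∘ uncurry ∘ rel) (allRels n)
    ≡⟨ relations-sum n _ (weighted-extensional separatedᵇ-cong (hasPairs k)) ⟩
  separatedSum n (hasPairs k) ∎
  where
  open ≡-Reasoning
  weight : ∀ R → (if isSeparatedNoZero R ∧ (numPairs R ≡ᵇ k) then 1 else 0)
                 ≡ weighted separatedᵇ (hasPairs k) (uncurry (rel R))
  weight R = trans (cong (λ b → if b ∧ (numPairs R ≡ᵇ k) then 1 else 0) (separatedᵇ-rel R))
                   (Bool.if-∧ (separatedᵇ (uncurry (rel R))))

mainTheorem10 : (n : ℕ) → 1 ≤ n → (k : ℕ) → numTypeB n k ≡ numSepNoZero (suc n) k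
mainTheorem10 n _ k = begin
  numTypeB n k
    ≡⟨ numTypeB≡typeBSum n k ⟩
  typeBSum n (hasBlocks k)
    ≡⟨ typeBSum≡separatedSum n (hasBlocks k) ⟩
  separatedSum (suc n) (hasBlocks k ∘ (_∸ 2))
    ≡⟨ separatedSum-cong (suc n) {hasBlocks k ∘ (_∸ 2)} {hasPairs k} (λ {h} _ → hasBlocks≡hasPairs k (classCount h)) ⟩
  separatedSum (suc n) (hasPairs k)
    ≡⟨ numSepNoZero≡separatedSum (suc n) k ⟨
  numSepNoZero (suc n) k ∎
  where open ≡-Reasoning
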